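{- Let $m \geqslant 2$ and $n_1,n_2 \geqslant 1$ be integers such that $q_1 = 1+mn_1$ and $q_2 = 1+mn_2$ are prime powers, and let $\alpha_1$ and $\alpha_2$ be primitive elements of $\operatorname{GF}(q_1)$ and $\operatorname{GF}(q_2)$, respectively. Then $\Gamma_m(\alpha_1,\alpha_2)$ is a Neumaier graph if and only if $q_1n_1 \equiv q_2n_2 \pmod 2$ and \[ \mathcal X^{(m)}_{0,0,0}(\alpha_1,\alpha_2) = q_1+n_1 n_2-2n_1-n_2. \] Furthermore, in that case $\Gamma_m(\alpha_1,\alpha_2)$ has parameters $\left (q_1 q_2, (q_1-1)(n_2+1), q_1-2+(n_1-1)n_2; n_1, q_1\right )$, and the number of common neighbours of any pair of distinct nonadjacent vertices belongs to the set \[ \{n_1(n_2+1)\} \cup \bigcup_{i=1}^{m-1} \left\{ 2n_1+ \mathcal X^{(m)}_{0,0,i}(\alpha_1,\alpha_2)\right\}. \]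
   Context: For a prime power $q \equiv 1 \pmod m$ and a primitive element $\alpha$ of $\operatorname{GF}(q)$, the cyclotomic number of order $m$ is, for $a,b\in\mathbb Z$, $c_m(\alpha;a,b) = |\{\alpha^k+1 : k \equiv a \pmod m\} \cap \{\alpha^k : k \equiv b \pmod m\}|$ (so it depends only on $a,b$ modulo $m$). Define $\mathcal X^{(m)}_{i,j,k}(\alpha_1,\alpha_2) = \sum_{a=0}^{m-1}\sum_{b=0}^{m-1} c_m(\alpha_1;a,b)\,c_m(\alpha_2;a+i-j,b+i-k)$. Let $\mathsf C_1(\alpha_1) = \{(\alpha_1^k,0): 0\le k\le q_1-2\}$ and, for $i\in\{0,\dots,m-1\}$, $\mathsf D_i(\alpha_1,\alpha_2) = \{(\alpha_1^{i_1},\alpha_2^{i_2}) : i_1-i_2 \equiv i \pmod m\}$, subsets of the additive group $\operatorname{GF}(q_1)\times\operatorname{GF}(q_2)$. The Cayley digraph $\operatorname{Cay}(G,S)$ of an abelian group $G$ has vertex set $G$ and arcs $(g,s+g)$ for $g\in G$, $s \in S$. Define $\Gamma_m(\alpha_1,\alpha_2) = \operatorname{Cay}(\operatorname{GF}(q_1)\times\operatorname{GF}(q_2), \mathsf C_1(\alpha_1)\cup \mathsf D_0(\alpha_1,\alpha_2))$. A graph is $(v,k,\lambda)$-edge-regular if it has $v$ vertices, is $k$-regular, and each edge lies in exactly $\lambda$ triangles. A clique $C$ is $e$-regular ($e>0$) if every vertex outside $C$ is adjacent to exactly $e$ vertices of $C$. A Neumaier graph is a non-complete (undirected, simple) edge-regular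 graph with a regular clique; it has parameters $(v,k,\lambda;e,s)$ if it is $(v,k,\lambda)$-edge-regular and has an $e$-regular clique of order $s$. -}

module Defs where

open import Level using (0ℓ)
open import Data.Nat as ℕ using (ℕ; zero; suc; _∸_; _<_; _≤_)
open import Data.Nat.Divisibility as ℕᵈ using (_∣?_)
open import Data.Integer as ℤ using (ℤ; +_)
open import Data.Integer.Divisibility as ℤᵈ using ()
open import Data.Fin as Fin using (Fin; toℕ)
open import Data.Fin.Properties using (any?; *↔×)
open import Data.List using (List; map; upTo)
open import Data.Nat.ListAction using (sum)
open import Data.Bool using (Bool; true; false)
open import Data.Product using (Σ; ∃; ∃-syntax; _×_; _,_; proj₁; proj₂)
open import Data.Product.Function.NonDependent.Propositional using (_×-↔_)
open import Data.Sum using (_⊎_; inj₁; inj₂)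
open import Data.Sum.Relation.Unary.All using ()
open import Function using (_↔_; Inverse)
open import Function.Properties.Inverse using (↔-trans)
open import Relation.Nullary using (¬_; Dec; yes; no; does)
open import Relation.Nullary.Decidable using (_×-dec_; _⊎-dec_; map′)
open import Relation.Binary.PropositionalEquality using (_≡_; _≢_; refl; sym; trans; cong)
open import Algebra.Core using (Op₁; Op₂)
open import Algebra.Structures using (IsCommutativeRing)

record FinType : Set₁ where
  field
    Elt  : Set
    size : ℕ
    enum : Fin size ↔ Elt

module _ (A : FinType) where
  open FinType A

  infix 4 _≟E_
  _≟E_ : (x y : Elt) → Dec (x ≡ y)
  x ≟E y with Inverse.from enum x Fin.≟ Inverse.from enum y
  ... | yes p = yes (trans (sym (Inverse.inverseˡ enum refl)) (Inverse.inverseˡ enum p))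
  ... | no ¬p = no (λ e → ¬p (cong (Inverse.from enum) e))

  countFin : (n : ℕ) → (Fin n → Bool) → ℕ
  countFin zero    f = 0
  countFin (suc n) f with f Fin.zero
  ... | true  = suc (countFin n (λ i → f (Fin.suc i)))
  ... | false = countFin n (λ i → f (Fin.suc i))

  count : (P : Elt → Set) → ((x : Elt) → Dec (P x)) → ℕ
  count P P? = countFin size (λ i → does (P? (Inverse.to enum i)))

  anyElt? : (P : Elt → Set) → ((x : Elt) → Dec (P x)) → Dec (∃[ x ] P x)
  anyElt? P P? = map′ (λ (i , p) → Inverse.to enum i , p)
                      (λ (x , p) → Inverse.from enum x , subst' p)
                      (any? (λ i → P? (Inverse.to enum i)))
    where
    subst' : ∀ {x} → P x → P (Inverse.to enum (Inverse.from enum x))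
    subst' {x} p rewrite Inverse.inverseˡ enum {x} refl = p

record FiniteField : Set₁ where
  infixl 6 _+_
  infixl 7 _*_
  infix  4 _≟_
  field
    Carrier : Set
    _+_ _*_ : Op₂ Carrier
    -_      : Op₁ Carrier
    0# 1#   : Carrier
    isCommutativeRing : IsCommutativeRing _≡_ _+_ _*_ -_ 0# 1#
    0≢1     : 0# ≢ 1#
    inverse : ∀ x → x ≢ 0# → ∃[ y ] (x * y ≡ 1#)
    order   : ℕ
    enum    : Fin order ↔ Carrier

  finType : FinType
  finType = record { Elt = Carrier ; size = order ; enum = enum }

  _≟_ : (x y : Carrier) → Dec (x ≡ y)
  _≟_ = _≟E_ finType

  infixr 8 _^_
  _^_ : Carrier → ℕ → Carrier
  x ^ zero  = 1#
  x ^ suc k = x * (x ^ k)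

  IsPrimitive : Carrier → Set
  IsPrimitive α = α ≢ 0# × (∀ x → x ≢ 0# → ∃[ k ] (α ^ k ≡ x))

_≡[_]ℤ_ : ℕ → ℕ → ℤ → Set
k ≡[ m ]ℤ a = (+ m) ℤᵈ.∣ ((+ k) ℤ.- a)

≡[]ℤ? : ∀ k m a → Dec (k ≡[ m ]ℤ a)
≡[]ℤ? k m a = ℤ.∣ + m ∣ ∣? ℤ.∣ (+ k) ℤ.- a ∣

-- Cyclotomic numbers c_m(α;a,b), a b ∈ ℤ.
-- The exponents k range over 0 ≤ k ≤ q-2 (which, as α^(q-1) = 1 and
-- m ∣ q-1, gives the same sets as k ranging over all of ℤ).

module _ (F : FiniteField) where
  open FiniteField F

  InPowClass : ℕ → Carrier → ℤ → Carrier → Set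
  InPowClass m α a x = ∃[ k ] (toℕ {order ∸ 1} k ≡[ m ]ℤ a × α ^ toℕ k ≡ x)

  InPowClass? : ∀ m α a x → Dec (InPowClass m α a x)
  InPowClass? m α a x = any? (λ k → ≡[]ℤ? (toℕ k) m a ×-dec (α ^ toℕ k ≟ x))

  InShiftedPowClass : ℕ → Carrier → ℤ → Carrier → Set
  InShiftedPowClass m α a x = ∃[ k ] (toℕ {order ∸ 1} k ≡[ m ]ℤ a × (α ^ toℕ k) + 1# ≡ x)

  InShiftedPowClass? : ∀ m α a x → Dec (InShiftedPowClass m α a x)
  InShiftedPowClass? m α a x = any? (λ k → ≡[]ℤ? (toℕ k) m a ×-dec ((α ^ toℕ k) + 1# ≟ x))

  cyclotomic : (m : ℕ) → (α : Carrier) → (a b : ℤ) → ℕ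
  cyclotomic m α a b =
    count finType (λ x → InShiftedPowClass m α a x × InPowClass m α b x)
                  (λ x → InShiftedPowClass? m α a x ×-dec InPowClass? m α b x)

𝒳 : (m : ℕ) → (i j k : ℤ) → (F₁ F₂ : FiniteField) →
    FiniteField.Carrier F₁ → FiniteField.Carrier F₂ → ℕ
𝒳 m i j k F₁ F₂ α₁ α₂ =
  sum (map (λ a → sum (map (λ b →
         cyclotomic F₁ m α₁ (+ a) (+ b) ℕ.*
         cyclotomic F₂ m α₂ ((+ a) ℤ.+ i ℤ.- j) ((+ b) ℤ.+ i ℤ.- k))
       (upTo m))) (upTo m))

record FinDigraph : Set₁ where
  field
    V    : FinType
    Adj  : FinType.Elt V → FinType.Elt V → Set
    Adj? : ∀ x y → Dec (Adj x y)

module _ (Γ : FinDigraph) where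
  open FinDigraph Γ
  open FinType V using (Elt; size)

  IsSimpleGraph : Set
  IsSimpleGraph = (∀ x y → Adj x y → Adj y x) × (∀ x → ¬ Adj x x)

  IsNonComplete : Set
  IsNonComplete = ∃[ x ] ∃[ y ] (x ≢ y × ¬ Adj x y)

  degree : Elt → ℕ
  degree x = count V (Adj x) (Adj? x)

  commonNeighbours : Elt → Elt → ℕ
  commonNeighbours x y = count V (λ z → Adj x z × Adj y z) (λ z → Adj? x z ×-dec Adj? y z)

  IsEdgeRegular : ℕ → ℕ → ℕ → Set
  IsEdgeRegular v k λ′ =
    size ≡ v × (∀ x → degree x ≡ k) × (∀ x y → Adj x y → commonNeighbours x y ≡ λ′)

  IsClique : (Elt → Bool) → Set
  IsClique C = ∀ x y → C x ≡ true → C y ≡ true → x ≢ y → Adj x y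

  cliqueOrder : (Elt → Bool) → ℕ
  cliqueOrder C = count V (λ x → C x ≡ true) (λ x → C x Data.Bool.≟ true)

  IsRegularClique : ℕ → (Elt → Bool) → Set
  IsRegularClique e C =
    IsClique C × 0 < e ×
    (∀ x → C x ≡ false →
       count V (λ y → C y ≡ true × Adj x y) (λ y → (C y Data.Bool.≟ true) ×-dec Adj? x y) ≡ e)

  IsNeumaier : Set
  IsNeumaier = IsSimpleGraph × IsNonComplete ×
               (∃[ v ] ∃[ k ] ∃[ λ′ ] IsEdgeRegular v k λ′) ×
               (∃[ e ] ∃[ C ] IsRegularClique e C)

  IsNeumaierWithParams : ℕ → ℕ → ℕ → ℕ → ℕ → Set
  IsNeumaierWithParams v k λ′ e s = IsSimpleGraph × IsNonComplete ×
               IsEdgeRegular v k λ′ ×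
               (∃[ C ] IsRegularClique e C × cliqueOrder C ≡ s)

module _ (F₁ F₂ : FiniteField) where
  private
    module F₁ = FiniteField F₁
    module F₂ = FiniteField F₂

  G : FinType
  G = record { Elt = F₁.Carrier × F₂.Carrier
             ; size = F₁.order ℕ.* F₂.order
             ; enum = ↔-trans *↔× (F₁.enum ×-↔ F₂.enum) }

  _+G_ : FinType.Elt G → FinType.Elt G → FinType.Elt G
  (x₁ , x₂) +G (y₁ , y₂) = (x₁ F₁.+ y₁) , (x₂ F₂.+ y₂)

  Cay : (S : FinType.Elt G → Set) → ((s : FinType.Elt G) → Dec (S s)) → FinDigraph
  Cay S S? = record
    { V = G
    ; Adj = λ g h → ∃[ s ] (S s × h ≡ s +G g)
    ; Adj? = λ g h → anyElt? G (λ s → S s × h ≡ s +G g)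
                       (λ s → S? s ×-dec _≟E_ G h (s +G g))
    }

  InC₁ : F₁.Carrier → FinType.Elt G → Set
  InC₁ α₁ (s₁ , s₂) = (∃[ k ] (α₁ F₁.^ toℕ {F₁.order ∸ 1} k ≡ s₁)) × s₂ ≡ F₂.0#

  InC₁? : ∀ α₁ s → Dec (InC₁ α₁ s)
  InC₁? α₁ (s₁ , s₂) = any? (λ k → (α₁ F₁.^ toℕ k) F₁.≟ s₁) ×-dec (s₂ F₂.≟ F₂.0#)

  -- D_i(α₁,α₂) = {(α₁^i₁, α₂^i₂) : i₁ - i₂ ≡ i (mod m)}
  -- (exponents taken in 0..q₁-2 and 0..q₂-2, which gives the same set)
  InD : ℕ → ℕ → F₁.Carrier → F₂.Carrier → FinType.Elt G → Set
  InD m i α₁ α₂ (s₁ , s₂) =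
    ∃[ i₁ ] ∃[ i₂ ] ((toℕ {F₁.order ∸ 1} i₁ ≡[ m ]ℤ ((+ toℕ {F₂.order ∸ 1} i₂) ℤ.+ (+ i)))
                     × α₁ F₁.^ toℕ i₁ ≡ s₁ × α₂ F₂.^ toℕ i₂ ≡ s₂)

  InD? : ∀ m i α₁ α₂ s → Dec (InD m i α₁ α₂ s)
  InD? m i α₁ α₂ (s₁ , s₂) =
    any? (λ i₁ → any? (λ i₂ →
      ≡[]ℤ? (toℕ i₁) m ((+ toℕ i₂) ℤ.+ (+ i)) ×-dec
      ((α₁ F₁.^ toℕ i₁) F₁.≟ s₁ ×-dec (α₂ F₂.^ toℕ i₂) F₂.≟ s₂)))

  Γ : ℕ → F₁.Carrier → F₂.Carrier → FinDigraph
  Γ m α₁ α₂ = Cay (λ s → InC₁ α₁ s ⊎ InD m 0 α₁ α₂ s)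
                  (λ s → InC₁? α₁ s ⊎-dec InD? m 0 α₁ α₂ s)

{-# OPTIONS --safe #-}
module Submission where

-- Γ_m(α₁, α₂) is the Cayley graph of GF(q₁) × GF(q₂) with connection set S = C₁ ∪ D₀, where,
-- writing ind for the discrete logarithm to base α₁ resp. α₂, C₁ = {(x, 0) : x ≠ 0} and
-- D₀ = {(x, y) : x, y ≠ 0, ind x ≡ ind y (mod m)}.  S = -S, i.e. Γ is undirected, iff ind(-1)
-- agrees mod m in the two fields; as 2 ind(-1) is 0 in characteristic 2 and q - 1 otherwise,
-- this is the parity condition.  The common neighbours of 0 and d are the w ∈ S with
-- w - d ∈ S; sorting w and w - d into C₁ and D₀ reduces their number to sizes of cyclotomic
-- classes, except for the part with both in D₀, which the substitution w ↦ (d₁/w₁, d₂/w₂)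
-- turns into the sum 𝒳_{0,0,i} with i ≡ ind d₁ - ind d₂.  So edges in C₁ lie in
-- q₁ - 2 + (n₁ - 1) n₂ triangles and edges in D₀ in 2 (n₁ - 1) + 𝒳_{0,0,0}, and Γ is
-- edge-regular iff these agree.  GF(q₁) × {0} is a clique of order q₁, and a vertex off it
-- is adjacent to exactly n₁ of its points.

open import Defs
open import Level using (0ℓ)
open import Data.Nat as ℕ using (ℕ; zero; suc; _∸_; _%_; _≤_; _<_; z≤n; s≤s; NonZero)
import Data.Nat.DivMod as ℕ
import Data.Nat.Properties as ℕ
import Algebra.Properties.CommutativeSemigroup ℕ.*-commutativeSemigroup as ℕ*
import Algebra.Properties.CommutativeSemigroup as CommutativeSemigroupProperties
open import Data.Nat.Divisibility using (∣⇒≤; n∣m*n) renaming (_∣_ to _ℕ∣_)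
open import Data.Integer as ℤ using (ℤ; +_; -[1+_])
import Data.Integer.Properties as ℤ
open import Data.Integer.Solver using (module +-*-Solver)
import Data.Nat.Solver as ℕ-Solver
open import Data.Integer.DivMod using (_%ℕ_; _/ℕ_; n%ℕd<d; a≡a%ℕn+[a/ℕn]*n)
open import Data.Integer.Divisibility.Signed using (_∣_; divides; _∣?_; ∣ᵤ⇒∣; ∣⇒∣ᵤ; ∣m∣n⇒∣m+n; ∣m⇒∣-m)
open import Data.Bool as Bool using (Bool; true; false; T; _∨_)
open import Data.Bool.Properties using (T-irrelevant; not-¬)
open import Data.Empty using (⊥-elim)
open import Data.Unit using (⊤; tt)
open import Data.Fin as Fin using (Fin; toℕ)
import Data.Fin.Properties as Fin
open import Data.Fin.Permutation using (↔⇒≡)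
open import Data.Product using (Σ; Σ-syntax; ∃-syntax; ∃₂; _×_; _,_; proj₁; proj₂; swap; uncurry)
open import Data.Product.Function.NonDependent.Propositional using (_×-↔_; _×-⇔_)
open import Data.Product.Function.Dependent.Propositional using (Σ-↔)
open import Data.Sum as Sum using (_⊎_; inj₁; inj₂; [_,_])
open import Data.Sum.Function.Propositional using (_⊎-↔_)
open import Data.List using (map; applyUpTo)
open import Data.Nat.ListAction using (sum)
open import Function using (_↔_; _⇔_; Inverse; Injection; Equivalence; mk↔ₛ′; mk⇔; _∘_; id)
open import Function.Properties.Inverse using (↔-refl; ↔-sym; ↔-trans; ↔⇒↣; ↔⇒⇔)
open import Function.Related.TypeIsomorphisms using (×-distribʳ-⊎; ×-distribˡ-⊎)
import Function.Properties.Equivalence as ⇔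
import Function.Related.Propositional as Related
open import Algebra.Bundles using (CommutativeRing)
open import Algebra.Structures using (IsCommutativeRing)
import Algebra.Properties.Ring as RingProperties
import Algebra.Properties.AbelianGroup as AbelianGroupProperties
import Algebra.Properties.Semiring.Mult as SemiringMult
open import Algebra.Solver.Ring.AlmostCommutativeRing using (fromCommutativeRing; _-Raw-AlmostCommutative⟶_)
import Algebra.Solver.Ring as RingSolverCore
open import Data.Sign as Sign using (Sign)
open import Data.Maybe using (Maybe; just; nothing)
import Relation.Binary.Reasoning.Setoid as SetoidReasoning
open import Relation.Nullary using (¬_; Dec; yes; no; does)
open import Relation.Nullary.Decidable using (_×-dec_; _⊎-dec_; ¬?; does-⇔; map′; dec-true)
open import Relation.Unary using (Decidable)
open import Relation.Binary.Definitions using (tri<; tri≈; tri>)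
open import Relation.Binary.PropositionalEquality
  using (_≡_; _≢_; refl; sym; trans; cong; cong₂; subst; subst₂; module ≡-Reasoning)

-- Counting in finite types

Witness : (A : FinType) {P : FinType.Elt A → Set} → Decidable P → Set
Witness A P? = Σ[ x ∈ FinType.Elt A ] T (does (P? x))

T-does⇒ : {P : Set} (P? : Dec P) → T (does P?) → P
T-does⇒ (yes p) _ = p

⇒T-does : {P : Set} (P? : Dec P) → P → T (does P?)
⇒T-does (yes _) _ = tt
⇒T-does (no ¬p) p = ¬p p

does≡true⇒ : {P : Set} (P? : Dec P) → does P? ≡ true → P
does≡true⇒ (yes p) _ = p

Σ-Fin-suc↔ : ∀ {n} (P : Fin (suc n) → Set) → (Σ[ i ∈ Fin (suc n) ] P i) ↔ (P Fin.zero ⊎ Σ[ i ∈ Fin n ] P (Fin.suc i))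
Σ-Fin-suc↔ {n} P = mk↔ₛ′ to from to∘from from∘to
  where
  to : (Σ[ i ∈ Fin (suc n) ] P i) → P Fin.zero ⊎ Σ[ i ∈ Fin n ] P (Fin.suc i)
  to (Fin.zero  , p) = inj₁ p
  to (Fin.suc i , p) = inj₂ (i , p)
  from : P Fin.zero ⊎ Σ[ i ∈ Fin n ] P (Fin.suc i) → Σ[ i ∈ Fin (suc n) ] P i
  from (inj₁ p)       = Fin.zero , p
  from (inj₂ (i , p)) = Fin.suc i , p
  to∘from : ∀ w → to (from w) ≡ w
  to∘from (inj₁ _) = refl
  to∘from (inj₂ _) = refl
  from∘to : ∀ w → from (to w) ≡ w
  from∘to (Fin.zero  , _) = refl
  from∘to (Fin.suc _ , _) = refl

¬A⇒A⊎B↔B : {A B : Set} → ¬ A → (A ⊎ B) ↔ B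
¬A⇒A⊎B↔B ¬a = mk↔ₛ′ [ ⊥-elim ∘ ¬a , id ] inj₂ (λ _ → refl) [ ⊥-elim ∘ ¬a , (λ _ → refl) ]

witness-≡ : ∀ {A : Set} {f : A → Bool} {x y : A} {p : T (f x)} {q : T (f y)} →
            x ≡ y → _≡_ {A = Σ A (T ∘ f)} (x , p) (y , q)
witness-≡ refl = cong (_ ,_) (T-irrelevant _ _)

module _ (A : FinType) where
  open FinType A

  countFin↔ : ∀ n (f : Fin n → Bool) → Fin (countFin A n f) ↔ (Σ[ i ∈ Fin n ] T (f i))
  countFin↔ zero    f = mk↔ₛ′ (λ ()) (λ ()) (λ ()) (λ ())
  countFin↔ (suc n) f with f Fin.zero in f0≡
  ... | true  = ↔-trans (Fin.+↔⊎ {1}) (↔-trans (Fin1↔T0 ⊎-↔ countFin↔ n (f ∘ Fin.suc)) (↔-sym (Σ-Fin-suc↔ (T ∘ f))))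
    where
    Fin1↔T0 : Fin 1 ↔ T (f Fin.zero)
    Fin1↔T0 = subst (λ b → Fin 1 ↔ T b) (sym f0≡) Fin.1↔⊤
  ... | false = ↔-trans (countFin↔ n (f ∘ Fin.suc)) (↔-sym (↔-trans (Σ-Fin-suc↔ (T ∘ f)) (¬A⇒A⊎B↔B (subst T f0≡))))

  countFin-∨ : ∀ n (f g : Fin n → Bool) → (∀ i → T (f i) → ¬ T (g i)) →
               countFin A n (λ i → f i ∨ g i) ≡ countFin A n f ℕ.+ countFin A n g
  countFin-∨ zero    f g _    = refl
  countFin-∨ (suc n) f g disj with f Fin.zero | g Fin.zero | disj Fin.zero
  ... | true  | true  | d = ⊥-elim (d tt tt)
  ... | true  | false | _ = cong suc (countFin-∨ n _ _ (disj ∘ Fin.suc))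
  ... | false | true  | _ = trans (cong suc (countFin-∨ n _ _ (disj ∘ Fin.suc))) (sym (ℕ.+-suc _ _))
  ... | false | false | _ = countFin-∨ n _ _ (disj ∘ Fin.suc)

  countFin-cong : ∀ n {f g : Fin n → Bool} → (∀ i → f i ≡ g i) → countFin A n f ≡ countFin A n g
  countFin-cong zero    _   = refl
  countFin-cong (suc n) {f} {g} f≗g with f Fin.zero | g Fin.zero | f≗g Fin.zero
  ... | true  | .true  | refl = cong suc (countFin-cong n (f≗g ∘ Fin.suc))
  ... | false | .false | refl = countFin-cong n (f≗g ∘ Fin.suc)

  count↔ : {P : Elt → Set} (P? : Decidable P) → Fin (count A P P?) ↔ Witness A P?
  count↔ P? = ↔-trans (countFin↔ size _) (Σ-↔ enum ↔-refl)

  count-is : {P : Elt → Set} (P? : Decidable P) {k : ℕ} → Witness A P? ↔ Fin k → count A P P? ≡ k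
  count-is P? e = ↔⇒≡ (↔-trans (count↔ P?) e)

  count-ext : {P Q : Elt → Set} (P? : Decidable P) (Q? : Decidable Q) →
              (∀ x → P x ⇔ Q x) → count A P P? ≡ count A Q Q?
  count-ext P? Q? P⇔Q = countFin-cong size (λ i → does-⇔ (P⇔Q _) (P? _) (Q? _))

  count-⊎ : {P Q R : Elt → Set} (P? : Decidable P) (Q? : Decidable Q) (R? : Decidable R) →
            (∀ x → P x ⇔ (Q x ⊎ R x)) → (∀ x → Q x → ¬ R x) →
            count A P P? ≡ count A Q Q? ℕ.+ count A R R?
  count-⊎ P? Q? R? split disjoint =
    trans (countFin-cong size (λ i → does-⇔ (split _) (P? _) (Q? _ ⊎-dec R? _)))
          (countFin-∨ size _ _ (λ i q r → disjoint _ (T-does⇒ (Q? _) q) (T-does⇒ (R? _) r)))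

  count-≡0 : {P : Elt → Set} (P? : Decidable P) → (∀ x → ¬ P x) → count A P P? ≡ 0
  count-≡0 P? ¬P = count-is P? (mk↔ₛ′ absurd (λ ()) (λ ()) (λ w → absurd w))
    where
    absurd : {B : Set} → Witness A P? → B
    absurd (x , p) = ⊥-elim (¬P x (T-does⇒ (P? x) p))

  count-≡1 : {P : Elt → Set} (P? : Decidable P) (c : Elt) → P c → (∀ x → P x → x ≡ c) →
             count A P P? ≡ 1
  count-≡1 P? c Pc unique = count-is P? (mk↔ₛ′ (λ _ → Fin.zero) (λ _ → c , ⇒T-does (P? c) Pc)
    (λ { Fin.zero → refl ; (Fin.suc ()) }) (λ (x , p) → witness-≡ (sym (unique x (T-does⇒ (P? x) p)))))

  count-all : count A (λ _ → ⊤) (λ _ → yes tt) ≡ size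
  count-all = count-is (λ _ → yes tt) (mk↔ₛ′ (Inverse.from enum ∘ proj₁) (λ i → Inverse.to enum i , tt)
    (Inverse.strictlyInverseʳ enum) (λ (x , _) → witness-≡ (Inverse.strictlyInverseˡ enum x)))

  count-remove : {P : Elt → Set} (P? : Decidable P) (c : Elt) → P c →
                 count A P P? ≡ suc (count A (λ x → P x × x ≢ c) (λ x → P? x ×-dec ¬? (_≟E_ A x c)))
  count-remove {P} P? c Pc = begin
    count A P P?                           ≡⟨ count-⊎ P? P≢c? ≡c? split (λ x (_ , x≢c) → x≢c) ⟩
    count A _ P≢c? ℕ.+ count A _ ≡c?       ≡⟨ cong (count A _ P≢c? ℕ.+_) (count-≡1 ≡c? c refl (λ _ → id)) ⟩
    count A _ P≢c? ℕ.+ 1                   ≡⟨ ℕ.+-comm _ 1 ⟩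
    suc (count A _ P≢c?)                   ∎
    where
    open ≡-Reasoning
    P≢c? : Decidable (λ x → P x × x ≢ c)
    P≢c? x = P? x ×-dec ¬? (_≟E_ A x c)
    ≡c? : Decidable (_≡ c)
    ≡c? x = _≟E_ A x c
    split : ∀ x → P x ⇔ ((P x × x ≢ c) ⊎ x ≡ c)
    split x with _≟E_ A x c
    ... | yes x≡c = mk⇔ (λ _ → inj₂ x≡c) (λ _ → subst P (sym x≡c) Pc)
    ... | no  x≢c = mk⇔ (λ Px → inj₁ (Px , x≢c)) [ proj₁ , (λ x≡c → ⊥-elim (x≢c x≡c)) ]

  count-remove-∉ : {P : Elt → Set} (P? : Decidable P) (c : Elt) → ¬ P c →
                   count A (λ x → P x × x ≢ c) (λ x → P? x ×-dec ¬? (_≟E_ A x c)) ≡ count A P P?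
  count-remove-∉ {P} P? c ¬Pc = count-ext (λ x → P? x ×-dec ¬? (_≟E_ A x c)) P?
    (λ x → mk⇔ proj₁ (λ Px → Px , λ x≡c → ¬Pc (subst P x≡c Px)))

infixr 7 _⊗_
_⊗_ : FinType → FinType → FinType
A ⊗ B = record
  { Elt  = FinType.Elt A × FinType.Elt B
  ; size = FinType.size A ℕ.* FinType.size B
  ; enum = ↔-trans Fin.*↔× (FinType.enum A ×-↔ FinType.enum B)
  }

module _ (A B : FinType) where
  private
    module A = FinType A
    module B = FinType B

  count-↔ : {P : A.Elt → Set} {Q : B.Elt → Set} (P? : Decidable P) (Q? : Decidable Q) →
            Witness A P? ↔ Witness B Q? → count A P P? ≡ count B Q Q?
  count-↔ P? Q? e = ↔⇒≡ (↔-trans (count↔ A P?) (↔-trans e (↔-sym (count↔ B Q?))))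

  count-bij : {P : A.Elt → Set} {Q : B.Elt → Set} (P? : Decidable P) (Q? : Decidable Q) →
              (f : A.Elt → B.Elt) (g : B.Elt → A.Elt) →
              (∀ x → P x → Q (f x)) → (∀ y → Q y → P (g y)) →
              (∀ x → P x → g (f x) ≡ x) → (∀ y → Q y → f (g y) ≡ y) →
              count A P P? ≡ count B Q Q?
  count-bij P? Q? f g P⇒Qf Q⇒Pg gf≡ fg≡ = count-↔ P? Q? (mk↔ₛ′
    (λ (x , p) → f x , ⇒T-does (Q? (f x)) (P⇒Qf x (T-does⇒ (P? x) p)))
    (λ (y , q) → g y , ⇒T-does (P? (g y)) (Q⇒Pg y (T-does⇒ (Q? y) q)))
    (λ (y , q) → witness-≡ (fg≡ y (T-does⇒ (Q? y) q)))
    (λ (x , p) → witness-≡ (gf≡ x (T-does⇒ (P? x) p))))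


module _ (A B : FinType) where
  private
    module A = FinType A
    module B = FinType B

  count-⊗ : {R : A.Elt × B.Elt → Set} (R? : Decidable R)
            {P : A.Elt → Set} (P? : Decidable P) {Q : A.Elt → B.Elt → Set} (Q? : ∀ x → Decidable (Q x)) (c : ℕ) →
            (∀ x y → R (x , y) ⇔ (P x × Q x y)) → (∀ x → P x → count B (Q x) (Q? x) ≡ c) →
            count (A ⊗ B) R R? ≡ count A P P? ℕ.* c
  count-⊗ {R} R? {P} P? {Q} Q? c R⇔PQ fibre = count-is (A ⊗ B) R? (begin
    Witness (A ⊗ B) R?                                ↔⟨ curried ⟩
    (Σ[ (x , _) ∈ Witness A P? ] Witness B (Q? x))    ↔⟨ Σ-↔ ↔-refl (λ {(x , p)} → fibre↔ x (T-does⇒ (P? x) p)) ⟩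
    (Witness A P? × Fin c)                            ↔⟨ ↔-sym (count↔ A P?) ×-↔ ↔-refl ⟩
    (Fin (count A P P?) × Fin c)                      ↔⟨ ↔-sym Fin.*↔× ⟩
    Fin (count A P P? ℕ.* c)                            ∎)
    where
    open Related.EquationalReasoning
    fibre↔ : ∀ x → P x → Witness B (Q? x) ↔ Fin c
    fibre↔ x Px = subst (λ k → Witness B (Q? x) ↔ Fin k) (fibre x Px) (↔-sym (count↔ B (Q? x)))
    curried : Witness (A ⊗ B) R? ↔ (Σ[ (x , _) ∈ Witness A P? ] Witness B (Q? x))
    curried = mk↔ₛ′
      (λ ((x , y) , r) → let (p , q) = Equivalence.to (R⇔PQ x y) (T-does⇒ (R? _) r) in
                         (x , ⇒T-does (P? x) p) , (y , ⇒T-does (Q? x y) q))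
      (λ ((x , p) , (y , q)) → (x , y) , ⇒T-does (R? _) (Equivalence.from (R⇔PQ x y) (T-does⇒ (P? x) p , T-does⇒ (Q? x y) q)))
      (λ ((x , p) , (y , q)) → cong₂ (λ p q → (x , p) , (y , q)) (T-irrelevant _ _) (T-irrelevant _ _))
      (λ ((x , y) , r) → witness-≡ refl)

  count-⊗-graph : {R : A.Elt × B.Elt → Set} (R? : Decidable R) {P : A.Elt → Set} (P? : Decidable P)
                  (g : A.Elt → B.Elt) → (∀ x y → R (x , y) ⇔ (P x × y ≡ g x)) →
                  count (A ⊗ B) R R? ≡ count A P P?
  count-⊗-graph R? P? g R⇔ = trans
    (count-⊗ R? P? (λ x y → _≟E_ B y (g x)) 1 R⇔ (λ x _ → count-≡1 B (λ y → _≟E_ B y (g x)) (g x) refl (λ _ → id)))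
    (ℕ.*-identityʳ _)

  count-⊗-swap : {R : A.Elt × B.Elt → Set} (R? : Decidable R) →
                 count (A ⊗ B) R R? ≡ count (B ⊗ A) (R ∘ swap) (R? ∘ swap)
  count-⊗-swap R? = count-bij (A ⊗ B) (B ⊗ A) R? (R? ∘ swap) swap swap (λ _ → id) (λ _ → id) (λ _ _ → refl) (λ _ _ → refl)

Fin-sum↔Σ : ∀ n (f g : ℕ → ℕ) → Fin (sum (map f (applyUpTo g n))) ↔ (Σ[ i ∈ Fin n ] Fin (f (g (toℕ i))))
Fin-sum↔Σ zero    f g = mk↔ₛ′ (λ ()) (λ ()) (λ ()) (λ ())
Fin-sum↔Σ (suc n) f g = ↔-trans Fin.+↔⊎ (↔-trans (↔-refl ⊎-↔ Fin-sum↔Σ n f (g ∘ suc)) (↔-sym (Σ-Fin-suc↔ _)))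

-- Congruence of integers modulo m

module Congruence (m : ℕ) where
  open +-*-Solver using (solve; _:=_; _:+_; _:-_; _:*_; :-_)

  infix 4 _≋_ _≋?_
  -- A record rather than a definition, so that a and b can be inferred from a ≋ b.
  record _≋_ (a b : ℤ) : Set where
    constructor mk≋
    field m∣a-b : + m ∣ a ℤ.- b
  open _≋_

  _≋?_ : ∀ a b → Dec (a ≋ b)
  a ≋? b = map′ mk≋ m∣a-b (+ m ∣? a ℤ.- b)

  ≋-refl : ∀ {a} → a ≋ a
  ≋-refl {a} = mk≋ (divides (+ 0) (ℤ.+-inverseʳ a))

  ≋-reflexive : ∀ {a b} → a ≡ b → a ≋ b
  ≋-reflexive refl = ≋-refl

  ≋-sym : ∀ {a b} → a ≋ b → b ≋ a
  ≋-sym {a} {b} (mk≋ m∣a-b) =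
    mk≋ (subst (+ m ∣_) (solve 2 (λ a b → :- (a :- b) := b :- a) refl a b) (∣m⇒∣-m m∣a-b))

  ≋-trans : ∀ {a b c} → a ≋ b → b ≋ c → a ≋ c
  ≋-trans {a} {b} {c} (mk≋ m∣a-b) (mk≋ m∣b-c) =
    mk≋ (subst (+ m ∣_) (solve 3 (λ a b c → (a :- b) :+ (b :- c) := a :- c) refl a b c) (∣m∣n⇒∣m+n m∣a-b m∣b-c))

  +-cong : ∀ {a b c d} → a ≋ b → c ≋ d → a ℤ.+ c ≋ b ℤ.+ d
  +-cong {a} {b} {c} {d} (mk≋ m∣a-b) (mk≋ m∣c-d) =
    mk≋ (subst (+ m ∣_) (solve 4 (λ a b c d → (a :- b) :+ (c :- d) := (a :+ c) :- (b :+ d)) refl a b c d)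
               (∣m∣n⇒∣m+n m∣a-b m∣c-d))

  neg-cong : ∀ {a b} → a ≋ b → ℤ.- a ≋ ℤ.- b
  neg-cong {a} {b} (mk≋ m∣a-b) =
    mk≋ (subst (+ m ∣_) (solve 2 (λ a b → :- (a :- b) := :- a :- :- b) refl a b) (∣m⇒∣-m m∣a-b))

  -‿cong : ∀ {a b c d} → a ≋ b → c ≋ d → a ℤ.- c ≋ b ℤ.- d
  -‿cong a≋b c≋d = +-cong a≋b (neg-cong c≋d)

  +-multiple : ∀ a k → a ℤ.+ k ℤ.* + m ≋ a
  +-multiple a k = mk≋ (divides k (solve 3 (λ a k m → (a :+ k :* m) :- a := k :* m) refl a k (+ m)))

  +[a+k*m]≋+a : ∀ a k → + (a ℕ.+ k ℕ.* m) ≋ + a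
  +[a+k*m]≋+a a k = subst (_≋ + a) (sym (trans (ℤ.pos-+ a (k ℕ.* m)) (cong (ℤ._+_ (+ a)) (ℤ.pos-* k m))))
                          (+-multiple (+ a) (+ k))

  ≋-transpose : ∀ {a b c} → a ℤ.+ b ≋ c → a ≋ c ℤ.- b
  ≋-transpose {a} {b} a+b≋c =
    ≋-trans (≋-reflexive (solve 2 (λ a b → a := (a :+ b) :- b) refl a b)) (-‿cong a+b≋c ≋-refl)

  ≋-cancelˡ : ∀ {a b c} → c ≋ (c ℤ.+ b) ℤ.- a → a ≋ b
  ≋-cancelˡ {a} {b} {c} c≋c+b-a = ≋-trans (≋-reflexive (solve 3 (λ a b c → a := (c :+ b) :- ((c :+ b) :- a)) refl a b c))
    (≋-trans (-‿cong (≋-refl {c ℤ.+ b}) (≋-sym c≋c+b-a)) (≋-reflexive (solve 2 (λ b c → (c :+ b) :- c := b) refl b c)))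

  ≋-cancelʳ : ∀ {a b c} → a ≋ b → (c ℤ.+ b) ℤ.- a ≋ c
  ≋-cancelʳ {a} {b} {c} a≋b =
    ≋-trans (-‿cong (≋-refl {c ℤ.+ b}) a≋b) (≋-reflexive (solve 2 (λ b c → (c :+ b) :- b := c) refl b c))

  ≋-isolate : ∀ {a b c e} → a ≋ (e ℤ.+ b) ℤ.- c → b ≋ (a ℤ.- e) ℤ.+ c
  ≋-isolate {a} {b} {c} {e} a≋e+b-c =
    ≋-trans (≋-reflexive (solve 3 (λ b c e → b := (((e :+ b) :- c) :- e) :+ c) refl b c e))
            (+-cong (-‿cong (≋-sym a≋e+b-c) (≋-refl {e})) (≋-refl {c}))

  ≋⇔-≋0 : ∀ {a b} → a ≋ b ⇔ a ℤ.- b ≋ + 0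
  ≋⇔-≋0 {a} {b} = mk⇔
    (λ a≋b → ≋-trans (-‿cong a≋b (≋-refl {b})) (≋-reflexive (ℤ.+-inverseʳ b)))
    (λ a-b≋0 → ≋-trans (≋-reflexive (solve 2 (λ a b → a := (a :- b) :+ b) refl a b))
                       (≋-trans (+-cong a-b≋0 (≋-refl {b})) (≋-reflexive (ℤ.+-identityˡ b))))

  +-cancelˡ : ∀ {a b c d} → a ≋ b → a ℤ.+ c ≋ b ℤ.+ d → c ≋ d
  +-cancelˡ {a} {b} {c} {d} a≋b a+c≋b+d =
    ≋-trans (≋-reflexive (solve 2 (λ a c → c := (a :+ c) :- a) refl a c))
            (≋-trans (-‿cong a+c≋b+d a≋b) (≋-reflexive (solve 2 (λ b d → (b :+ d) :- b := d) refl b d)))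

  ≡[]ℤ⇔≋ : ∀ {k a} → k ≡[ m ]ℤ a ⇔ + k ≋ a
  ≡[]ℤ⇔≋ = mk⇔ (mk≋ ∘ ∣ᵤ⇒∣) (∣⇒∣ᵤ ∘ m∣a-b)

  module _ .{{_ : NonZero m}} where

    residue : ℤ → ℕ
    residue a = a %ℕ m

    residue<m : ∀ a → residue a < m
    residue<m a = n%ℕd<d a m

    ≋-residue : ∀ a → a ≋ + residue a
    ≋-residue a = subst (_≋ + residue a) (sym (a≡a%ℕn+[a/ℕn]*n a m)) (+-multiple (+ residue a) (a /ℕ m))

    ≋-<⇒≡ : ∀ {u v} → u < m → v < m → + u ≋ + v → u ≡ v
    ≋-<⇒≡ {u} {v} u<m v<m u≋v =
      ℤ.+-injective (ℤ.i-j≡0⇒i≡j _ _ (ℤ.∣i∣≡0⇒i≡0 (multiple<m⇒≡0 (∣⇒∣ᵤ (m∣a-b u≋v)) distance<m)))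
      where
      distance<m : ℤ.∣ + u ℤ.- + v ∣ < m
      distance<m = subst (_< m) (cong ℤ.∣_∣ (sym (ℤ.m-n≡m⊖n u v)))
                         (ℕ.≤-<-trans (ℤ.∣m⊝n∣≤m⊔n u v) (ℕ.⊔-lub u<m v<m))
      multiple<m⇒≡0 : ∀ {k} → m ℕ∣ k → k < m → k ≡ 0
      multiple<m⇒≡0 {zero}  _   _   = refl
      multiple<m⇒≡0 {suc k} m∣k k<m = ⊥-elim (ℕ.<⇒≱ k<m (∣⇒≤ m∣k))

    +k≋+[k%m] : ∀ k → + k ≋ + (k % m)
    +k≋+[k%m] k = subst (λ l → + l ≋ + (k % m)) (sym (ℕ.m≡m%n+[m/n]*n k m)) (+[a+k*m]≋+a (k % m) (k ℕ./ m))

    residue-unique : ∀ {a u} → u < m → a ≋ + u → residue a ≡ u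
    residue-unique {a} u<m a≋u = ≋-<⇒≡ (residue<m a) u<m (≋-trans (≋-sym (≋-residue a)) a≋u)

    residue-cong : ∀ {a b} → a ≋ b → residue a ≡ residue b
    residue-cong {a} {b} a≋b = residue-unique (residue<m b) (≋-trans a≋b (≋-residue b))

    residueFin : ℤ → Fin m
    residueFin a = Fin.fromℕ< (residue<m a)

    ≋-residueFin : ∀ a → a ≋ + toℕ (residueFin a)
    ≋-residueFin a = ≋-trans (≋-residue a) (≋-reflexive (cong +_ (sym (Fin.toℕ-fromℕ< (residue<m a)))))

    residueFin-unique : ∀ {a} {u : Fin m} → a ≋ + toℕ u → residueFin a ≡ u
    residueFin-unique {a} {u} a≋u = Fin.toℕ-injective (trans (Fin.toℕ-fromℕ< (residue<m a)) (residue-unique (Fin.toℕ<n u) a≋u))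

module _ (m : ℕ) .{{_ : NonZero m}} where
  private
    module Mod-m = Congruence m
    module Mod-2 = Congruence 2
  open +-*-Solver using (solve; _:=_; _:-_; _:*_; con)

  -- Both directions cancel a common factor in 2 (e₁ - e₂) = m (k₁ - k₂).
  halves-≋⇔parity : ∀ {e₁ e₂ k₁ k₂} → 2 ℕ.* e₁ ≡ m ℕ.* k₁ → 2 ℕ.* e₂ ≡ m ℕ.* k₂ →
                    (+ e₁ Mod-m.≋ + e₂) ⇔ (k₁ % 2 ≡ k₂ % 2)
  halves-≋⇔parity {e₁} {e₂} {k₁} {k₂} 2e₁≡mk₁ 2e₂≡mk₂ = mk⇔ to from
    where
    open ≡-Reasoning
    lift : ∀ {e k} → 2 ℕ.* e ≡ m ℕ.* k → + 2 ℤ.* + e ≡ + m ℤ.* + k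
    lift {e} {k} 2e≡mk = trans (sym (ℤ.pos-* 2 e)) (trans (cong +_ 2e≡mk) (ℤ.pos-* m k))
    2[e₁-e₂]≡m[k₁-k₂] : + 2 ℤ.* (+ e₁ ℤ.- + e₂) ≡ + m ℤ.* (+ k₁ ℤ.- + k₂)
    2[e₁-e₂]≡m[k₁-k₂] = begin
      + 2 ℤ.* (+ e₁ ℤ.- + e₂)             ≡⟨ solve 3 (λ c a b → c :* (a :- b) := c :* a :- c :* b) refl (+ 2) (+ e₁) (+ e₂) ⟩
      + 2 ℤ.* + e₁ ℤ.- + 2 ℤ.* + e₂       ≡⟨ cong₂ ℤ._-_ (lift {e₁} {k₁} 2e₁≡mk₁) (lift {e₂} {k₂} 2e₂≡mk₂) ⟩
      + m ℤ.* + k₁ ℤ.- + m ℤ.* + k₂       ≡⟨ solve 3 (λ c a b → c :* a :- c :* b := c :* (a :- b)) refl (+ m) (+ k₁) (+ k₂) ⟩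
      + m ℤ.* (+ k₁ ℤ.- + k₂)             ∎
    to : + e₁ Mod-m.≋ + e₂ → k₁ % 2 ≡ k₂ % 2
    to (Mod-m.mk≋ (divides t e₁-e₂≡t*m)) = Mod-2.residue-cong {+ k₁} {+ k₂} (Mod-2.mk≋ (divides t (ℤ.*-cancelˡ-≡ (+ m) _ _ (begin
      + m ℤ.* (+ k₁ ℤ.- + k₂)   ≡⟨ 2[e₁-e₂]≡m[k₁-k₂] ⟨
      + 2 ℤ.* (+ e₁ ℤ.- + e₂)   ≡⟨ cong (+ 2 ℤ.*_) e₁-e₂≡t*m ⟩
      + 2 ℤ.* (t ℤ.* + m)       ≡⟨ solve 2 (λ t m → con (+ 2) :* (t :* m) := m :* (t :* con (+ 2))) refl t (+ m) ⟩
      + m ℤ.* (t ℤ.* + 2)       ∎))))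
    from : k₁ % 2 ≡ k₂ % 2 → + e₁ Mod-m.≋ + e₂
    from k₁%2≡k₂%2 with Mod-2.≋-trans (Mod-2.+k≋+[k%m] k₁)
                          (Mod-2.≋-trans (Mod-2.≋-reflexive (cong +_ k₁%2≡k₂%2)) (Mod-2.≋-sym (Mod-2.+k≋+[k%m] k₂)))
    ... | Mod-2.mk≋ (divides t k₁-k₂≡t*2) = Mod-m.mk≋ (divides t (ℤ.*-cancelˡ-≡ (+ 2) _ _ (begin
      + 2 ℤ.* (+ e₁ ℤ.- + e₂)   ≡⟨ 2[e₁-e₂]≡m[k₁-k₂] ⟩
      + m ℤ.* (+ k₁ ℤ.- + k₂)   ≡⟨ cong (+ m ℤ.*_) k₁-k₂≡t*2 ⟩
      + m ℤ.* (t ℤ.* + 2)       ≡⟨ solve 2 (λ t m → m :* (t :* con (+ 2)) := con (+ 2) :* (t :* m)) refl t (+ m) ⟩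
      + 2 ℤ.* (t ℤ.* + m)       ∎)))

-- With integer coefficients the normal forms of both sides compute, so that
-- identities such as (x + y) - y = x are closed by refl; this needs the
-- canonical homomorphism ι : ℤ → R.
module IntegerCoefficientSolver {c ℓ} (R : CommutativeRing c ℓ) where
  open CommutativeRing R renaming (refl to ≈-refl; sym to ≈-sym; trans to ≈-trans; reflexive to ≈-reflexive)
  open RingProperties ring using (-‿involutive; -0#≈0#; -1*x≈-x)
  open AbelianGroupProperties +-abelianGroup using (⁻¹-∙-comm)
  open SemiringMult semiring using (×-homo-+; ×1-homo-*) renaming (_×_ to _·1#-times_)
  open SetoidReasoning setoid
  open CommutativeSemigroupProperties +-commutativeSemigroup using () renaming (x∙yz≈y∙xz to x+[y+z]≈y+[x+z])
  open CommutativeSemigroupProperties *-commutativeSemigroup using () renaming (x∙yz≈y∙xz to x*[y*z]≈y*[x*z])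

  ι⁺ : ℕ → Carrier
  ι⁺ n = n ·1#-times 1#

  ι : ℤ → Carrier
  ι (+ n)    = ι⁺ n
  ι -[1+ n ] = - ι⁺ (suc n)

  ι-⊖ : ∀ m n → ι (m ℤ.⊖ n) ≈ ι⁺ m + - ι⁺ n
  ι-⊖ zero    zero    = ≈-sym (≈-trans (+-congˡ -0#≈0#) (+-identityʳ 0#))
  ι-⊖ (suc m) zero    = ≈-sym (≈-trans (+-congˡ -0#≈0#) (+-identityʳ _))
  ι-⊖ zero    (suc n) = ≈-sym (+-identityˡ _)
  ι-⊖ (suc m) (suc n) = begin
    ι (suc m ℤ.⊖ suc n)                   ≡⟨ cong ι (ℤ.[1+m]⊖[1+n]≡m⊖n m n) ⟩
    ι (m ℤ.⊖ n)                           ≈⟨ ι-⊖ m n ⟩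
    ι⁺ m + - ι⁺ n                         ≈⟨ ≈-sym (+-identityˡ _) ⟩
    0# + (ι⁺ m + - ι⁺ n)                  ≈⟨ +-congʳ (≈-sym (-‿inverseʳ 1#)) ⟩
    (1# + - 1#) + (ι⁺ m + - ι⁺ n)         ≈⟨ +-assoc _ _ _ ⟩
    1# + (- 1# + (ι⁺ m + - ι⁺ n))         ≈⟨ +-congˡ (x+[y+z]≈y+[x+z] _ _ _) ⟩
    1# + (ι⁺ m + (- 1# + - ι⁺ n))         ≈⟨ ≈-sym (+-assoc _ _ _) ⟩
    (1# + ι⁺ m) + (- 1# + - ι⁺ n)         ≈⟨ +-congˡ (⁻¹-∙-comm _ _) ⟩
    (1# + ι⁺ m) + - (1# + ι⁺ n)           ∎

  ι-+ : ∀ i j → ι (i ℤ.+ j) ≈ ι i + ι j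
  ι-+ -[1+ m ] -[1+ n ] = begin
    - (1# + (1# + ι⁺ (m ℕ.+ n)))          ≈⟨ -‿cong (+-congˡ (+-congˡ (×-homo-+ 1# m n))) ⟩
    - (1# + (1# + (ι⁺ m + ι⁺ n)))         ≈⟨ -‿cong (+-congˡ (x+[y+z]≈y+[x+z] _ _ _)) ⟩
    - (1# + (ι⁺ m + (1# + ι⁺ n)))         ≈⟨ -‿cong (≈-sym (+-assoc _ _ _)) ⟩
    - ((1# + ι⁺ m) + (1# + ι⁺ n))         ≈⟨ ≈-sym (⁻¹-∙-comm _ _) ⟩
    - (1# + ι⁺ m) + - (1# + ι⁺ n)         ∎
  ι-+ -[1+ m ] (+ n)    = ≈-trans (ι-⊖ n (suc m)) (+-comm _ _)
  ι-+ (+ m)    -[1+ n ] = ι-⊖ m (suc n)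
  ι-+ (+ m)    (+ n)    = ×-homo-+ 1# m n

  ι-sign : Sign → Carrier
  ι-sign Sign.+ = 1#
  ι-sign Sign.- = - 1#

  ι-sign-* : ∀ s t → ι-sign (s Sign.* t) ≈ ι-sign s * ι-sign t
  ι-sign-* Sign.- Sign.- = ≈-sym (≈-trans (-1*x≈-x (- 1#)) (-‿involutive 1#))
  ι-sign-* Sign.- Sign.+ = ≈-sym (*-identityʳ _)
  ι-sign-* Sign.+ Sign.- = ≈-sym (*-identityˡ _)
  ι-sign-* Sign.+ Sign.+ = ≈-sym (*-identityˡ _)

  ι-◃ : ∀ s n → ι (s ℤ.◃ n) ≈ ι-sign s * ι⁺ n
  ι-◃ s       zero    = ≈-sym (zeroʳ _)
  ι-◃ Sign.+ (suc n) = ≈-sym (*-identityˡ _)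
  ι-◃ Sign.- (suc n) = ≈-sym (-1*x≈-x _)

  ι-sign-abs : ∀ i → ι i ≈ ι-sign (ℤ.sign i) * ι⁺ ℤ.∣ i ∣
  ι-sign-abs i = ≈-trans (≈-reflexive (cong ι (sym (ℤ.◃-inverse i)))) (ι-◃ (ℤ.sign i) ℤ.∣ i ∣)

  ι-* : ∀ i j → ι (i ℤ.* j) ≈ ι i * ι j
  ι-* i j = begin
    ι (i ℤ.* j)                                          ≈⟨ ι-◃ (ℤ.sign i Sign.* ℤ.sign j) (ℤ.∣ i ∣ ℕ.* ℤ.∣ j ∣) ⟩
    ι-sign (ℤ.sign i Sign.* ℤ.sign j) * ι⁺ (ℤ.∣ i ∣ ℕ.* ℤ.∣ j ∣)
                                                         ≈⟨ *-cong (ι-sign-* (ℤ.sign i) (ℤ.sign j)) (×1-homo-* ℤ.∣ i ∣ ℤ.∣ j ∣) ⟩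
    (s * t) * (a * b)                                    ≈⟨ *-assoc _ _ _ ⟩
    s * (t * (a * b))                                    ≈⟨ *-congˡ (x*[y*z]≈y*[x*z] _ _ _) ⟩
    s * (a * (t * b))                                    ≈⟨ ≈-sym (*-assoc _ _ _) ⟩
    (s * a) * (t * b)                                    ≈⟨ *-cong (≈-sym (ι-sign-abs i)) (≈-sym (ι-sign-abs j)) ⟩
    ι i * ι j                                            ∎
    where
    s t a b : Carrier
    s = ι-sign (ℤ.sign i)
    t = ι-sign (ℤ.sign j)
    a = ι⁺ ℤ.∣ i ∣
    b = ι⁺ ℤ.∣ j ∣

  ι-neg : ∀ i → ι (ℤ.- i) ≈ - ι i
  ι-neg -[1+ n ]    = ≈-sym (-‿involutive _)
  ι-neg (+ zero)    = ≈-sym -0#≈0#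
  ι-neg (+ (suc n)) = ≈-refl

  ι-homomorphism : ℤ.+-*-rawRing -Raw-AlmostCommutative⟶ fromCommutativeRing R
  ι-homomorphism = record
    { ⟦_⟧ = ι ; +-homo = ι-+ ; *-homo = ι-* ; -‿homo = ι-neg ; 0-homo = ≈-refl ; 1-homo = +-identityʳ 1# }

  ι-equal? : (i j : ℤ) → Maybe (ι i ≈ ι j)
  ι-equal? i j with i ℤ.≟ j
  ... | yes i≡j = just (≈-reflexive (cong ι i≡j))
  ... | no  _   = nothing

  open RingSolverCore ℤ.+-*-rawRing (fromCommutativeRing R) ι-homomorphism ι-equal? public

-- Finite fields

module FieldProperties (F : FiniteField) where
  open FiniteField F public
  open IsCommutativeRing isCommutativeRing public
    using (+-assoc; +-comm; +-identityˡ; +-identityʳ; -‿inverseˡ; -‿inverseʳ;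
           *-assoc; *-comm; *-identityˡ; *-identityʳ; zeroˡ; zeroʳ)
  open ≡-Reasoning

  commutativeRing : CommutativeRing 0ℓ 0ℓ
  commutativeRing = record { isCommutativeRing = isCommutativeRing }

  open RingProperties (CommutativeRing.ring commutativeRing) public
    using (-‿involutive; -0#≈0#; -1*x≈-x)
  open IntegerCoefficientSolver commutativeRing public
    using (solve; _:=_; _:+_; _:*_; :-_; _:-_)

  infixl 6 _-_
  _-_ : Carrier → Carrier → Carrier
  x - y = x + - y

  x-0≡x : ∀ x → x - 0# ≡ x
  x-0≡x x = trans (cong (_+_ x) -0#≈0#) (+-identityʳ x)

  0-x≡-x : ∀ x → 0# - x ≡ - x
  0-x≡-x x = +-identityˡ (- x)

  x≡y⇒x-y≡0 : ∀ {x y} → x ≡ y → x - y ≡ 0#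
  x≡y⇒x-y≡0 {x} refl = -‿inverseʳ x

  [x+y]-y≡x : ∀ x y → x + y - y ≡ x
  [x+y]-y≡x x y = solve 2 (λ x y → x :+ y :- y := x) refl x y

  [x-y]+y≡x : ∀ x y → x - y + y ≡ x
  [x-y]+y≡x x y = solve 2 (λ x y → x :- y :+ y := x) refl x y

  1≢0 : 1# ≢ 0#
  1≢0 = 0≢1 ∘ sym

  x-y≡0⇒x≡y : ∀ {x y} → x - y ≡ 0# → x ≡ y
  x-y≡0⇒x≡y {x} {y} x-y≡0 = begin
    x             ≡⟨ solve 2 (λ x y → x := (x :- y) :+ y) refl x y ⟩
    (x - y) + y   ≡⟨ cong (_+ y) x-y≡0 ⟩
    0# + y        ≡⟨ +-identityˡ y ⟩
    y             ∎

  x≢y⇒x-y≢0 : ∀ {x y} → x ≢ y → x - y ≢ 0#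
  x≢y⇒x-y≢0 x≢y = x≢y ∘ x-y≡0⇒x≡y

  -‿≢0 : ∀ {x} → x ≢ 0# → - x ≢ 0#
  -‿≢0 {x} x≢0 -x≡0 = x≢0 (trans (sym (-‿involutive x)) (trans (cong -_ -x≡0) -0#≈0#))

  -- Junk value 0⁻¹ = 0.
  infix 8 _⁻¹
  _⁻¹ : Carrier → Carrier
  x ⁻¹ with x ≟ 0#
  ... | yes _   = 0#
  ... | no  x≢0 = proj₁ (inverse x x≢0)

  0⁻¹≡0 : 0# ⁻¹ ≡ 0#
  0⁻¹≡0 with 0# ≟ 0#
  ... | yes _   = refl
  ... | no  0≢0 = ⊥-elim (0≢0 refl)

  *-inverseʳ : ∀ {x} → x ≢ 0# → x * x ⁻¹ ≡ 1#
  *-inverseʳ {x} x≢0 with x ≟ 0#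
  ... | yes x≡0 = ⊥-elim (x≢0 x≡0)
  ... | no  x≢0 = proj₂ (inverse x x≢0)

  x⁻¹*[x*y]≡y : ∀ {x} y → x ≢ 0# → x ⁻¹ * (x * y) ≡ y
  x⁻¹*[x*y]≡y {x} y x≢0 = begin
    x ⁻¹ * (x * y)   ≡⟨ solve 3 (λ x x⁻¹ y → x⁻¹ :* (x :* y) := (x :* x⁻¹) :* y) refl x (x ⁻¹) y ⟩
    (x * x ⁻¹) * y   ≡⟨ cong (_* y) (*-inverseʳ x≢0) ⟩
    1# * y           ≡⟨ *-identityˡ y ⟩
    y                ∎

  *-cancelˡ : ∀ {x y z} → x ≢ 0# → x * y ≡ x * z → y ≡ z
  *-cancelˡ {x} {y} {z} x≢0 xy≡xz =
    trans (sym (x⁻¹*[x*y]≡y y x≢0)) (trans (cong (x ⁻¹ *_) xy≡xz) (x⁻¹*[x*y]≡y z x≢0))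

  no-zero-divisors : ∀ {x y} → x * y ≡ 0# → x ≡ 0# ⊎ y ≡ 0#
  no-zero-divisors {x} {y} xy≡0 with x ≟ 0#
  ... | yes x≡0 = inj₁ x≡0
  ... | no  x≢0 = inj₂ (*-cancelˡ x≢0 (trans xy≡0 (sym (zeroʳ x))))

  *-≢0 : ∀ {x y} → x ≢ 0# → y ≢ 0# → x * y ≢ 0#
  *-≢0 x≢0 y≢0 xy≡0 = [ x≢0 , y≢0 ] (no-zero-divisors xy≡0)

  ⁻¹-unique : ∀ {x y} → x * y ≡ 1# → x ⁻¹ ≡ y
  ⁻¹-unique {x} {y} xy≡1 = *-cancelˡ x≢0 (trans (*-inverseʳ x≢0) (sym xy≡1))
    where
    x≢0 : x ≢ 0#
    x≢0 x≡0 = 0≢1 (trans (sym (zeroˡ y)) (trans (cong (_* y) (sym x≡0)) xy≡1))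

  ⁻¹-≢0 : ∀ {x} → x ≢ 0# → x ⁻¹ ≢ 0#
  ⁻¹-≢0 {x} x≢0 x⁻¹≡0 = 1≢0 (trans (sym (*-inverseʳ x≢0)) (trans (cong (x *_) x⁻¹≡0) (zeroʳ x)))

  1⁻¹≡1 : 1# ⁻¹ ≡ 1#
  1⁻¹≡1 = ⁻¹-unique (*-identityˡ 1#)

  infixl 7 _/_
  _/_ : Carrier → Carrier → Carrier
  x / y = x * y ⁻¹

  x/y≢0 : ∀ {x y} → x ≢ 0# → y ≢ 0# → x / y ≢ 0#
  x/y≢0 x≢0 y≢0 = *-≢0 x≢0 (⁻¹-≢0 y≢0)

  x/[x/y]≡y : ∀ {x y} → x ≢ 0# → y ≢ 0# → x / (x / y) ≡ y
  x/[x/y]≡y {x} {y} x≢0 y≢0 = begin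
    x * (x / y) ⁻¹   ≡⟨ cong (x *_) (⁻¹-unique x/y*y/x≡1) ⟩
    x * (y * x ⁻¹)   ≡⟨ solve 3 (λ x y x⁻¹ → x :* (y :* x⁻¹) := y :* (x :* x⁻¹)) refl x y (x ⁻¹) ⟩
    y * (x * x ⁻¹)   ≡⟨ cong (y *_) (*-inverseʳ x≢0) ⟩
    y * 1#           ≡⟨ *-identityʳ y ⟩
    y                ∎
    where
    x/y*y/x≡1 : (x / y) * (y * x ⁻¹) ≡ 1#
    x/y*y/x≡1 = begin
      (x * y ⁻¹) * (y * x ⁻¹)     ≡⟨ solve 4 (λ x y x⁻¹ y⁻¹ → (x :* y⁻¹) :* (y :* x⁻¹) := (x :* x⁻¹) :* (y :* y⁻¹))
                                            refl x y (x ⁻¹) (y ⁻¹) ⟩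
      (x * x ⁻¹) * (y * y ⁻¹)     ≡⟨ cong₂ _*_ (*-inverseʳ x≢0) (*-inverseʳ y≢0) ⟩
      1# * 1#                     ≡⟨ *-identityˡ 1# ⟩
      1#                          ∎

  x/y≡1⇒x≡y : ∀ {x y} → x ≢ 0# → x / y ≡ 1# → x ≡ y
  x/y≡1⇒x≡y {x} {y} x≢0 x/y≡1 = begin
    x              ≡⟨ sym (*-identityʳ x) ⟩
    x * 1#         ≡⟨ cong (x *_) (sym 1⁻¹≡1) ⟩
    x / 1#         ≡⟨ cong (x /_) (sym x/y≡1) ⟩
    x / (x / y)    ≡⟨ x/[x/y]≡y x≢0 y≢0 ⟩
    y              ∎
    where
    y≢0 : y ≢ 0#
    y≢0 refl = 0≢1 (trans (sym (zeroʳ x)) (trans (cong (x *_) (sym 0⁻¹≡0)) x/y≡1))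

  x/y*y≡x : ∀ {x y} → y ≢ 0# → x / y * y ≡ x
  x/y*y≡x {x} {y} y≢0 = begin
    x * y ⁻¹ * y     ≡⟨ solve 3 (λ x y y⁻¹ → x :* y⁻¹ :* y := x :* (y :* y⁻¹)) refl x y (y ⁻¹) ⟩
    x * (y * y ⁻¹)   ≡⟨ cong (x *_) (*-inverseʳ y≢0) ⟩
    x * 1#           ≡⟨ *-identityʳ x ⟩
    x                ∎

  x/y≢1 : ∀ {x y} → x ≢ 0# → y ≢ x → x / y ≢ 1#
  x/y≢1 x≢0 y≢x x/y≡1 = y≢x (sym (x/y≡1⇒x≡y x≢0 x/y≡1))

  x/y-1≡-[y-x]/y : ∀ {x y} → y ≢ 0# → x / y - 1# ≡ - (y - x) / y
  x/y-1≡-[y-x]/y {x} {y} y≢0 = begin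
    x * y ⁻¹ - 1#              ≡⟨ cong (λ z → x * y ⁻¹ - z) (*-inverseʳ y≢0) ⟨
    x * y ⁻¹ - y * y ⁻¹        ≡⟨ solve 3 (λ x y y⁻¹ → x :* y⁻¹ :- y :* y⁻¹ := (:- (y :- x)) :* y⁻¹) refl x y (y ⁻¹) ⟩
    - (y - x) * y ⁻¹           ∎

  x/y≢x : ∀ {x y} → x ≢ 0# → y ≢ 0# → y ≢ 1# → x / y ≢ x
  x/y≢x {x} {y} x≢0 y≢0 y≢1 x/y≡x = y≢1 (begin
    y              ≡⟨ sym (x/[x/y]≡y x≢0 y≢0) ⟩
    x / (x / y)    ≡⟨ cong (x /_) x/y≡x ⟩
    x / x          ≡⟨ *-inverseʳ x≢0 ⟩
    1#             ∎)

  ^-+ : ∀ a k l → a ^ (k ℕ.+ l) ≡ a ^ k * a ^ l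
  ^-+ a zero    l = sym (*-identityˡ _)
  ^-+ a (suc k) l = trans (cong (a *_) (^-+ a k l)) (sym (*-assoc _ _ _))

  1^ : ∀ k → 1# ^ k ≡ 1#
  1^ zero    = refl
  1^ (suc k) = trans (*-identityˡ _) (1^ k)

  ^-* : ∀ a k l → a ^ (k ℕ.* l) ≡ (a ^ k) ^ l
  ^-* a k zero    = cong (a ^_) (ℕ.*-zeroʳ k)
  ^-* a k (suc l) = begin
    a ^ (k ℕ.* suc l)         ≡⟨ cong (a ^_) (ℕ.*-suc k l) ⟩
    a ^ (k ℕ.+ k ℕ.* l)       ≡⟨ ^-+ a k (k ℕ.* l) ⟩
    a ^ k * a ^ (k ℕ.* l)     ≡⟨ cong (a ^ k *_) (^-* a k l) ⟩
    a ^ k * (a ^ k) ^ l       ∎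

  ^-≢0 : ∀ {a} k → a ≢ 0# → a ^ k ≢ 0#
  ^-≢0 zero    _   = 1≢0
  ^-≢0 (suc k) a≢0 = *-≢0 a≢0 (^-≢0 k a≢0)

  ≢0? : Decidable (_≢ 0#)
  ≢0? x = ¬? (x ≟ 0#)

  suc-count-≢0 : suc (count finType (_≢ 0#) ≢0?) ≡ order
  suc-count-≢0 = begin
    suc (count finType (_≢ 0#) ≢0?)
      ≡⟨ cong suc (count-ext finType ≢0? (λ x → yes tt ×-dec ≢0? x) (λ _ → mk⇔ (tt ,_) proj₂)) ⟨
    suc (count finType (λ x → ⊤ × x ≢ 0#) (λ x → yes tt ×-dec ≢0? x)) ≡⟨ count-remove finType (λ _ → yes tt) 0# tt ⟨
    count finType (λ _ → ⊤) (λ _ → yes tt)             ≡⟨ count-all finType ⟩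
    order                                               ∎

  [x+y]² : ∀ x y → (x + y) * (x + y) ≡ (x * x + y * y) + (y + y) * x
  [x+y]² x y = solve 2 (λ x y → (x :+ y) :* (x :+ y) := (x :* x :+ y :* y) :+ (y :+ y) :* x) refl x y

  module _ (1+1≡0 : 1# + 1# ≡ 0#) where
    x+1≡0⇒x≡1 : ∀ {x} → x + 1# ≡ 0# → x ≡ 1#
    x+1≡0⇒x≡1 {x} x+1≡0 = begin
      x                  ≡⟨ +-identityʳ x ⟨
      x + 0#             ≡⟨ cong (_+_ x) 1+1≡0 ⟨
      x + (1# + 1#)      ≡⟨ +-assoc x 1# 1# ⟨
      (x + 1#) + 1#      ≡⟨ cong (_+ 1#) x+1≡0 ⟩
      0# + 1#            ≡⟨ +-identityˡ 1# ⟩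
      1#                 ∎

    x*x≡1⇒x≡1 : ∀ {x} → x * x ≡ 1# → x ≡ 1#
    x*x≡1⇒x≡1 {x} x*x≡1 = x+1≡0⇒x≡1 ([ id , id ] (no-zero-divisors [x+1]²≡0))
      where
      [x+1]²≡0 : (x + 1#) * (x + 1#) ≡ 0#
      [x+1]²≡0 = begin
        (x + 1#) * (x + 1#)                ≡⟨ [x+y]² x 1# ⟩
        (x * x + 1# * 1#) + (1# + 1#) * x  ≡⟨ cong₂ _+_ (cong₂ _+_ x*x≡1 (*-identityˡ 1#)) (cong (_* x) 1+1≡0) ⟩
        (1# + 1#) + 0# * x                 ≡⟨ cong₂ _+_ 1+1≡0 (zeroˡ x) ⟩
        0# + 0#                            ≡⟨ +-identityʳ 0# ⟩
        0#                                 ∎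

-- Discrete logarithms with respect to a primitive element

module DiscreteLog (F : FiniteField) (N : ℕ) .{{_ : NonZero N}}
                   (order≡1+N : FiniteField.order F ≡ suc N)
                   (α : FiniteField.Carrier F) (α-primitive : FiniteField.IsPrimitive F α) where
  open FieldProperties F
  open ≡-Reasoning

  α≢0 : α ≢ 0#
  α≢0 = proj₁ α-primitive

  α^≢0 : ∀ k → α ^ k ≢ 0#
  α^≢0 k = ^-≢0 k α≢0

  some-log : ∀ {x} → x ≢ 0# → ∃[ k ] α ^ k ≡ x
  some-log {x} x≢0 = proj₂ α-primitive x x≢0

  count-≢0 : count finType (_≢ 0#) ≢0? ≡ N
  count-≢0 = ℕ.suc-injective (trans suc-count-≢0 order≡1+N)

  nonzero↔Fin : Witness finType ≢0? ↔ Fin N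
  nonzero↔Fin = ↔-trans (↔-sym (count↔ finType ≢0?))
                        (subst (λ k → Fin (count finType _ ≢0?) ↔ Fin k) count-≢0 ↔-refl)

  α^-mod : ∀ d .{{_ : NonZero d}} → α ^ d ≡ 1# → ∀ k → α ^ k ≡ α ^ (k % d)
  α^-mod d α^d≡1 k = begin
    α ^ k                               ≡⟨ cong (α ^_) (ℕ.m≡m%n+[m/n]*n k d) ⟩
    α ^ (k % d ℕ.+ (k ℕ./ d) ℕ.* d)     ≡⟨ ^-+ α (k % d) _ ⟩
    α ^ (k % d) * α ^ ((k ℕ./ d) ℕ.* d) ≡⟨ cong (λ e → α ^ (k % d) * α ^ e) (ℕ.*-comm (k ℕ./ d) d) ⟩
    α ^ (k % d) * α ^ (d ℕ.* (k ℕ./ d)) ≡⟨ cong (α ^ (k % d) *_) (^-* α d (k ℕ./ d)) ⟩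
    α ^ (k % d) * (α ^ d) ^ (k ℕ./ d)   ≡⟨ cong (λ β → α ^ (k % d) * β ^ (k ℕ./ d)) α^d≡1 ⟩
    α ^ (k % d) * 1# ^ (k ℕ./ d)        ≡⟨ cong (α ^ (k % d) *_) (1^ (k ℕ./ d)) ⟩
    α ^ (k % d) * 1#                    ≡⟨ *-identityʳ _ ⟩
    α ^ (k % d)                         ∎

  α^i≡α^j⇒α^[j∸i]≡1 : ∀ {i j} → i ≤ j → α ^ i ≡ α ^ j → α ^ (j ∸ i) ≡ 1#
  α^i≡α^j⇒α^[j∸i]≡1 {i} {j} i≤j α^i≡α^j = *-cancelˡ (α^≢0 i) (begin
    α ^ i * α ^ (j ∸ i)   ≡⟨ ^-+ α i (j ∸ i) ⟨
    α ^ (i ℕ.+ (j ∸ i))   ≡⟨ cong (α ^_) (ℕ.m+[n∸m]≡n i≤j) ⟩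
    α ^ j                 ≡⟨ α^i≡α^j ⟨
    α ^ i                 ≡⟨ *-identityʳ _ ⟨
    α ^ i * 1#            ∎)

  -- α⁰, …, α^(d-1) already take all N nonzero values, since α^k = α^(k mod d).
  α^d≡1⇒N≤d : ∀ d → 0 < d → α ^ d ≡ 1# → N ≤ d
  α^d≡1⇒N≤d d@(suc _) _ α^d≡1 = Fin.injective⇒≤ {f = exponent} exponent-injective
    where
    element : Fin N → Witness finType ≢0?
    element = Inverse.from nonzero↔Fin
    element≢0 : ∀ i → proj₁ (element i) ≢ 0#
    element≢0 i = T-does⇒ (≢0? _) (proj₂ (element i))
    exponent : Fin N → Fin d
    exponent i = Fin.fromℕ< (ℕ.m%n<n (proj₁ (some-log (element≢0 i))) d)
    α^exponent : ∀ i → α ^ toℕ (exponent i) ≡ proj₁ (element i)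
    α^exponent i = let (k , α^k≡x) = some-log (element≢0 i) in begin
      α ^ toℕ (exponent i)   ≡⟨ cong (α ^_) (Fin.toℕ-fromℕ< (ℕ.m%n<n k d)) ⟩
      α ^ (k % d)            ≡⟨ α^-mod d α^d≡1 k ⟨
      α ^ k                  ≡⟨ α^k≡x ⟩
      proj₁ (element i)      ∎
    exponent-injective : ∀ {i j} → exponent i ≡ exponent j → i ≡ j
    exponent-injective {i} {j} eq = Injection.injective (↔⇒↣ (↔-sym nonzero↔Fin))
      (witness-≡ (trans (sym (α^exponent i)) (trans (cong (λ k → α ^ toℕ k) eq) (α^exponent j))))

  α^N≡1 : α ^ N ≡ 1#
  α^N≡1 = from-collision (Fin.pigeonhole (ℕ.n<1+n N) code)
    where
    code : Fin (suc N) → Fin N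
    code k = Inverse.to nonzero↔Fin (α ^ toℕ k , ⇒T-does (≢0? _) (α^≢0 (toℕ k)))
    from-collision : ∃₂ (λ i j → i Fin.< j × code i ≡ code j) → α ^ N ≡ 1#
    from-collision (i , j , i<j , same-code) = subst (λ d → α ^ d ≡ 1#) j∸i≡N α^[j∸i]≡1
      where
      α^[j∸i]≡1 : α ^ (toℕ j ∸ toℕ i) ≡ 1#
      α^[j∸i]≡1 = α^i≡α^j⇒α^[j∸i]≡1 (ℕ.<⇒≤ i<j) (cong proj₁ (Injection.injective (↔⇒↣ nonzero↔Fin) same-code))
      j∸i≡N : toℕ j ∸ toℕ i ≡ N
      j∸i≡N = ℕ.≤-antisym (ℕ.≤-trans (ℕ.m∸n≤m (toℕ j) (toℕ i)) (ℕ.≤-pred (Fin.toℕ<n j)))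
                          (α^d≡1⇒N≤d _ (ℕ.m<n⇒0<n∸m i<j) α^[j∸i]≡1)

  α^-distinct : ∀ {i j} → i < j → j < N → α ^ i ≢ α ^ j
  α^-distinct {i} {j} i<j j<N α^i≡α^j = ℕ.<⇒≱ (ℕ.≤-<-trans (ℕ.m∸n≤m j i) j<N)
    (α^d≡1⇒N≤d (j ∸ i) (ℕ.m<n⇒0<n∸m i<j) (α^i≡α^j⇒α^[j∸i]≡1 (ℕ.<⇒≤ i<j) α^i≡α^j))

  α^-injective : ∀ {i j} → i < N → j < N → α ^ i ≡ α ^ j → i ≡ j
  α^-injective {i} {j} i<N j<N α^i≡α^j with ℕ.<-cmp i j
  ... | tri≈ _ i≡j _ = i≡j
  ... | tri< i<j _ _ = ⊥-elim (α^-distinct i<j j<N α^i≡α^j)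
  ... | tri> _ _ j<i = ⊥-elim (α^-distinct j<i i<N (sym α^i≡α^j))

  α^≡α^⇒%≡% : ∀ {k l} → α ^ k ≡ α ^ l → k % N ≡ l % N
  α^≡α^⇒%≡% {k} {l} α^k≡α^l = α^-injective (ℕ.m%n<n k N) (ℕ.m%n<n l N)
    (trans (sym (α^-mod N α^N≡1 k)) (trans α^k≡α^l (α^-mod N α^N≡1 l)))

  -- Junk value 0 at x = 0.
  ind : Carrier → ℕ
  ind x with x ≟ 0#
  ... | yes _   = 0
  ... | no  x≢0 = proj₁ (some-log x≢0) % N

  α^ind : ∀ {x} → x ≢ 0# → α ^ ind x ≡ x
  α^ind {x} x≢0 with x ≟ 0#
  ... | yes x≡0 = ⊥-elim (x≢0 x≡0)
  ... | no  x≢0 = trans (sym (α^-mod N α^N≡1 _)) (proj₂ (some-log x≢0))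

  ind<N : ∀ x → ind x < N
  ind<N x with x ≟ 0#
  ... | yes _ = ℕ.>-nonZero⁻¹ N
  ... | no  _ = ℕ.m%n<n _ N

  ind-α^ : ∀ k → ind (α ^ k) ≡ k % N
  ind-α^ k = trans (sym (ℕ.m<n⇒m%n≡m (ind<N (α ^ k)))) (α^≡α^⇒%≡% (α^ind (α^≢0 k)))

  ind-unique : ∀ {k x} → k < N → α ^ k ≡ x → ind x ≡ k
  ind-unique {k} k<N refl = trans (ind-α^ k) (ℕ.m<n⇒m%n≡m k<N)

-- Cyclotomic classes of order m

module CyclotomicClasses (F : FiniteField) (m n : ℕ) .{{_ : NonZero m}} .{{_ : NonZero n}}
                         (order≡1+mn : FiniteField.order F ≡ suc (m ℕ.* n))
                         (α : FiniteField.Carrier F) (α-primitive : FiniteField.IsPrimitive F α) where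
  open FieldProperties F public
  open Congruence m public

  N : ℕ
  N = m ℕ.* n

  instance
    N≢0 : NonZero N
    N≢0 = ℕ.m*n≢0 m n

  open DiscreteLog F N order≡1+mn α α-primitive public

  +k≋+[k%N] : ∀ k → + k ≋ + (k % N)
  +k≋+[k%N] k = subst (λ l → + l ≋ + (k % N)) (sym k≡k%N+[[k/N]*n]*m) (+[a+k*m]≋+a (k % N) ((k ℕ./ N) ℕ.* n))
    where
    k≡k%N+[[k/N]*n]*m : k ≡ k % N ℕ.+ (k ℕ./ N) ℕ.* n ℕ.* m
    k≡k%N+[[k/N]*n]*m = trans (ℕ.m≡m%n+[m/n]*n k N)
      (cong (k % N ℕ.+_) (trans (cong ((k ℕ./ N) ℕ.*_) (ℕ.*-comm m n)) (sym (ℕ.*-assoc (k ℕ./ N) n m))))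

  α^≡α^⇒≋ : ∀ {k l} → α ^ k ≡ α ^ l → + k ≋ + l
  α^≡α^⇒≋ {k} {l} α^k≡α^l =
    ≋-trans (+k≋+[k%N] k) (≋-trans (≋-reflexive (cong +_ (α^≡α^⇒%≡% α^k≡α^l))) (≋-sym (+k≋+[k%N] l)))

  ind-≋ : ∀ {k x} → α ^ k ≡ x → + ind x ≋ + k
  ind-≋ {k} refl = α^≡α^⇒≋ (α^ind (α^≢0 k))

  ind-cong : ∀ {x y} → x ≡ y → + ind x ≋ + ind y
  ind-cong refl = ≋-refl

  ind-1 : ind 1# ≡ 0
  ind-1 = ind-unique (ℕ.>-nonZero⁻¹ N) refl

  ind-* : ∀ {x y} → x ≢ 0# → y ≢ 0# → + ind (x * y) ≋ + ind x ℤ.+ + ind y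
  ind-* {x} {y} x≢0 y≢0 = ≋-trans (α^≡α^⇒≋ α^ind[xy]≡α^[ind-x+ind-y]) (≋-reflexive (ℤ.pos-+ (ind x) (ind y)))
    where
    open ≡-Reasoning
    α^ind[xy]≡α^[ind-x+ind-y] : α ^ ind (x * y) ≡ α ^ (ind x ℕ.+ ind y)
    α^ind[xy]≡α^[ind-x+ind-y] = begin
      α ^ ind (x * y)           ≡⟨ α^ind (*-≢0 x≢0 y≢0) ⟩
      x * y                     ≡⟨ cong₂ _*_ (α^ind x≢0) (α^ind y≢0) ⟨
      α ^ ind x * α ^ ind y     ≡⟨ ^-+ α (ind x) (ind y) ⟨
      α ^ (ind x ℕ.+ ind y)     ∎

  ind-/ : ∀ {x y} → x ≢ 0# → y ≢ 0# → + ind (x / y) ≋ + ind x ℤ.- + ind y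
  ind-/ {x} {y} x≢0 y≢0 = ≋-transpose {b = + ind y} (≋-trans (≋-sym (ind-* (x/y≢0 x≢0 y≢0) y≢0)) (ind-cong (x/y*y≡x y≢0)))

  e : ℕ
  e = ind (- 1#)

  ind-neg : ∀ {x} → x ≢ 0# → + ind (- x) ≋ + e ℤ.+ + ind x
  ind-neg {x} x≢0 = ≋-trans (ind-cong (sym (-1*x≈-x x))) (ind-* (-‿≢0 1≢0) x≢0)

  ind-/-1 : ∀ {x y} → y ≢ 0# → y ≢ x → + ind (x / y - 1#) ≋ (+ e ℤ.+ + ind (y - x)) ℤ.- + ind y
  ind-/-1 {x} {y} y≢0 y≢x = ≋-trans (ind-cong (x/y-1≡-[y-x]/y y≢0))
    (≋-trans (ind-/ (-‿≢0 (x≢y⇒x-y≢0 y≢x)) y≢0) (-‿cong (ind-neg (x≢y⇒x-y≢0 y≢x)) (≋-refl {+ ind y})))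

  InClass : ℤ → Carrier → Set
  InClass j x = x ≢ 0# × + ind x ≋ j

  InClass? : ∀ j → Decidable (InClass j)
  InClass? j x = ≢0? x ×-dec (+ ind x ≋? j)

  indFin : Carrier → Fin (order ∸ 1)
  indFin x = Fin.fromℕ< (subst (ind x <_) (sym (cong (_∸ 1) order≡1+mn)) (ind<N x))

  toℕ-indFin : ∀ x → toℕ (indFin x) ≡ ind x
  toℕ-indFin x = Fin.toℕ-fromℕ< _

  InPowClass⇔InClass : ∀ {a x} → InPowClass F m α a x ⇔ InClass a x
  InPowClass⇔InClass {a} {x} = mk⇔
    (λ (k , k≡a , α^k≡x) → (λ x≡0 → α^≢0 (toℕ k) (trans α^k≡x x≡0)) ,
                           ≋-trans (ind-≋ α^k≡x) (Equivalence.to ≡[]ℤ⇔≋ k≡a))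
    (λ (x≢0 , ind-x≋a) → indFin x ,
                         Equivalence.from ≡[]ℤ⇔≋ (subst (λ k → + k ≋ a) (sym (toℕ-indFin x)) ind-x≋a) ,
                         trans (cong (α ^_) (toℕ-indFin x)) (α^ind x≢0))

  InShiftedPowClass⇔InClass : ∀ {a x} → InShiftedPowClass F m α a x ⇔ InClass a (x - 1#)
  InShiftedPowClass⇔InClass {a} {x} = mk⇔
    (λ (k , k≡a , α^k+1≡x) → Equivalence.to InPowClass⇔InClass (k , k≡a , shift-down α^k+1≡x))
    (λ x-1∈a → let (k , k≡a , α^k≡x-1) = Equivalence.from InPowClass⇔InClass x-1∈a in
               k , k≡a , shift-up α^k≡x-1)
    where
    shift-down : ∀ {y} → y + 1# ≡ x → y ≡ x - 1#
    shift-down {y} refl = solve 2 (λ y o → y := (y :+ o) :- o) refl y 1#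
    shift-up : ∀ {y} → y ≡ x - 1# → y + 1# ≡ x
    shift-up refl = solve 2 (λ x o → (x :- o) :+ o := x) refl x 1#

  module _ (j : ℤ) where
    private
      r : ℕ
      r = residue j
      exponent : Fin n → ℕ
      exponent t = r ℕ.+ toℕ t ℕ.* m
      exponent<N : ∀ t → exponent t < N
      exponent<N t = ℕ.<-≤-trans (ℕ.+-monoˡ-< (toℕ t ℕ.* m) (residue<m j))
                                 (ℕ.≤-trans (ℕ.*-monoˡ-≤ m (Fin.toℕ<n t)) (ℕ.≤-reflexive (ℕ.*-comm n m)))
      element : Fin n → Witness finType (InClass? j)
      element t = α ^ exponent t , ⇒T-does (InClass? j _)
        (α^≢0 (exponent t) , ≋-trans (ind-≋ refl) (≋-trans (+[a+k*m]≋+a r (toℕ t)) (≋-sym (≋-residue j))))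
      quotient<n : ∀ x → ind x ℕ./ m < n
      quotient<n x = ℕ.m<n*o⇒m/o<n (subst (ind x <_) (ℕ.*-comm m n) (ind<N x))
      index : Witness finType (InClass? j) → Fin n
      index (x , _) = Fin.fromℕ< (quotient<n x)
      index∘element : ∀ t → index (element t) ≡ t
      index∘element t = Fin.toℕ-injective (trans (Fin.toℕ-fromℕ< _) (begin
        ind (α ^ exponent t) ℕ./ m              ≡⟨ cong (ℕ._/ m) (ind-unique (exponent<N t) refl) ⟩
        (r ℕ.+ toℕ t ℕ.* m) ℕ./ m               ≡⟨ ℕ.+-distrib-/-∣ʳ r (n∣m*n (toℕ t)) ⟩
        r ℕ./ m ℕ.+ toℕ t ℕ.* m ℕ./ m           ≡⟨ cong₂ ℕ._+_ (ℕ.m<n⇒m/n≡0 (residue<m j)) (ℕ.m*n/n≡m (toℕ t) m) ⟩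
        toℕ t                                   ∎))
        where open ≡-Reasoning
      element∘index : ∀ w → element (index w) ≡ w
      element∘index (x , p) = witness-≡ (begin
        α ^ (r ℕ.+ toℕ (index (x , p)) ℕ.* m)   ≡⟨ cong (λ k → α ^ (r ℕ.+ k ℕ.* m)) (Fin.toℕ-fromℕ< (quotient<n x)) ⟩
        α ^ (r ℕ.+ ind x ℕ./ m ℕ.* m)           ≡⟨ cong (λ k → α ^ (k ℕ.+ ind x ℕ./ m ℕ.* m))
                                                        (residue-unique (ℕ.m%n<n (ind x) m) ind-x≋j) ⟩
        α ^ (ind x % m ℕ.+ ind x ℕ./ m ℕ.* m)   ≡⟨ cong (α ^_) (ℕ.m≡m%n+[m/n]*n (ind x) m) ⟨
        α ^ ind x                               ≡⟨ α^ind x≢0 ⟩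
        x                                       ∎)
        where
        open ≡-Reasoning
        x≢0 : x ≢ 0#
        x≢0 = proj₁ (T-does⇒ (InClass? j x) p)
        ind-x≋j : j ≋ + (ind x % m)
        ind-x≋j = ≋-trans (≋-sym (proj₂ (T-does⇒ (InClass? j x) p))) (+k≋+[k%m] (ind x))

    class-size : count finType (InClass j) (InClass? j) ≡ n
    class-size = count-is finType (InClass? j) (↔-sym (mk↔ₛ′ element index element∘index index∘element))

  count-InClass∖ : ℤ → Carrier → ℕ
  count-InClass∖ j c = count finType (λ w → InClass j w × w ≢ c) (λ w → InClass? j w ×-dec ¬? (w ≟ c))

  count-InClass∖-∈ : ∀ {j c} → InClass j c → count-InClass∖ j c ≡ n ∸ 1
  count-InClass∖-∈ {j} {c} c∈j = cong (_∸ 1) (trans (sym (count-remove finType (InClass? j) c c∈j)) (class-size j))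

  count-InClass∖-∉ : ∀ j c → ¬ InClass j c → count-InClass∖ j c ≡ n
  count-InClass∖-∉ j c c∉j = trans (count-remove-∉ finType (InClass? j) c c∉j) (class-size j)

  module _ (a : Carrier) (a≢0 : a ≢ 0#) where
    private
      f g : Carrier → Carrier
      f x = a / x - 1#
      g t = a / (t + 1#)
      y-1+1≡y : ∀ y → y - 1# + 1# ≡ y
      y-1+1≡y y = solve 2 (λ y o → y :- o :+ o := y) refl y 1#
      y+1-1≡y : ∀ y → y + 1# - 1# ≡ y
      y+1-1≡y y = solve 2 (λ y o → y :+ o :- o := y) refl y 1#
      f-maps : ∀ x → x ≢ 0# × x ≢ a × + ind x ≋ + ind (x - a) → InClass (+ e) (f x) × f x ≢ - 1#
      f-maps x (x≢0 , x≢a , ind-x≋ind[x-a]) =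
        (x≢y⇒x-y≢0 (x/y≢1 a≢0 x≢a) , ≋-trans (ind-/-1 x≢0 x≢a) (≋-cancelʳ ind-x≋ind[x-a])) ,
        λ f-x≡-1 → x/y≢0 a≢0 x≢0 (trans (sym (y-1+1≡y (a / x))) (trans (cong (_+ 1#) f-x≡-1) (-‿inverseˡ 1#)))
      t+1≢0 : ∀ {t} → t ≢ - 1# → t + 1# ≢ 0#
      t+1≢0 {t} t≢-1 t+1≡0 = t≢-1 (trans (sym (y+1-1≡y t)) (trans (cong (_- 1#) t+1≡0) (+-identityˡ (- 1#))))
      t+1≢1 : ∀ {t} → t ≢ 0# → t + 1# ≢ 1#
      t+1≢1 {t} t≢0 t+1≡1 = t≢0 (trans (sym (y+1-1≡y t)) (trans (cong (_- 1#) t+1≡1) (-‿inverseʳ 1#)))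
      f∘g : ∀ t → InClass (+ e) t × t ≢ - 1# → f (g t) ≡ t
      f∘g t (_ , t≢-1) = trans (cong (_- 1#) (x/[x/y]≡y a≢0 (t+1≢0 t≢-1))) (y+1-1≡y t)
      g-maps : ∀ t → InClass (+ e) t × t ≢ - 1# → g t ≢ 0# × g t ≢ a × + ind (g t) ≋ + ind (g t - a)
      g-maps t t∈e∖-1@((t≢0 , ind-t≋e) , t≢-1) =
        g-t≢0 , g-t≢a , ≋-cancelˡ (≋-trans (≋-sym ind-t≋e)
          (subst (λ s → + ind s ≋ (+ e ℤ.+ + ind (g t - a)) ℤ.- + ind (g t)) (f∘g t t∈e∖-1) (ind-/-1 g-t≢0 g-t≢a)))
        where
        g-t≢0 : g t ≢ 0#
        g-t≢0 = x/y≢0 a≢0 (t+1≢0 t≢-1)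
        g-t≢a : g t ≢ a
        g-t≢a = x/y≢x a≢0 (t+1≢0 t≢-1) (t+1≢1 t≢0)
      g∘f : ∀ x → x ≢ 0# × x ≢ a × + ind x ≋ + ind (x - a) → g (f x) ≡ x
      g∘f x (x≢0 , _) = trans (cong (a /_) (y-1+1≡y (a / x))) (x/[x/y]≡y a≢0 x≢0)

    -- x ↦ a/x - 1 maps these x onto the class of -1 with -1 itself removed.
    count-ind≋ind[-a] :
      count finType (λ x → x ≢ 0# × x ≢ a × + ind x ≋ + ind (x - a))
                    (λ x → ≢0? x ×-dec ¬? (x ≟ a) ×-dec (+ ind x ≋? + ind (x - a))) ≡ n ∸ 1
    count-ind≋ind[-a] = trans
      (count-bij finType finType (λ x → ≢0? x ×-dec ¬? (x ≟ a) ×-dec (+ ind x ≋? + ind (x - a)))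
                 (λ t → InClass? (+ e) t ×-dec ¬? (t ≟ - 1#)) f g f-maps g-maps g∘f f∘g)
      (count-InClass∖-∈ (-‿≢0 1≢0 , ≋-refl))

  module _ (1+1≡0 : 1# + 1# ≡ 0#) where
    e≡0-in-char-2 : e ≡ 0
    e≡0-in-char-2 = trans (cong ind (x+1≡0⇒x≡1 1+1≡0 (-‿inverseˡ 1#))) ind-1

    N-odd-in-char-2 : ∀ t → N ≢ 2 ℕ.* t
    N-odd-in-char-2 t N≡2t = ℕ.<⇒≱ t<N (α^d≡1⇒N≤d t 0<t (x*x≡1⇒x≡1 1+1≡0 α^t*α^t≡1))
      where
      open ≡-Reasoning
      0<t : 0 < t
      0<t = ℕ.n≢0⇒n>0 (λ t≡0 → ℕ.<-irrefl (sym (trans N≡2t (cong (2 ℕ.*_) t≡0))) (ℕ.>-nonZero⁻¹ N))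
      t<N : t < N
      t<N = subst (t <_) (sym N≡2t) (subst (t <_) (cong (t ℕ.+_) (sym (ℕ.+-identityʳ t))) (ℕ.m<m+n t 0<t))
      α^t*α^t≡1 : α ^ t * α ^ t ≡ 1#
      α^t*α^t≡1 = begin
        α ^ t * α ^ t      ≡⟨ ^-+ α t t ⟨
        α ^ (t ℕ.+ t)      ≡⟨ cong (λ s → α ^ (t ℕ.+ s)) (ℕ.+-identityʳ t) ⟨
        α ^ (2 ℕ.* t)      ≡⟨ cong (α ^_) N≡2t ⟨
        α ^ N              ≡⟨ α^N≡1 ⟩
        1#                 ∎

  module _ (1+1≢0 : 1# + 1# ≢ 0#) where
    2e≡N-in-odd-char : 2 ℕ.* e ≡ N
    2e≡N-in-odd-char = trans 2e≡q*N (trans (cong (ℕ._* N) q≡1) (ℕ.*-identityˡ N))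
      where
      open ≡-Reasoning
      -1≢0 : - 1# ≢ 0#
      -1≢0 = -‿≢0 1≢0
      e≢0 : e ≢ 0
      e≢0 e≡0 = 1+1≢0 (begin
        1# + 1#           ≡⟨ cong (_+ 1#) (trans (sym (α^ind -1≢0)) (cong (α ^_) e≡0)) ⟨
        - 1# + 1#         ≡⟨ -‿inverseˡ 1# ⟩
        0#                ∎)
      α^2e≡α^0 : α ^ (2 ℕ.* e) ≡ α ^ 0
      α^2e≡α^0 = begin
        α ^ (2 ℕ.* e)     ≡⟨ cong (λ s → α ^ (e ℕ.+ s)) (ℕ.+-identityʳ e) ⟩
        α ^ (e ℕ.+ e)     ≡⟨ ^-+ α e e ⟩
        α ^ e * α ^ e     ≡⟨ cong₂ _*_ (α^ind -1≢0) (α^ind -1≢0) ⟩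
        - 1# * - 1#       ≡⟨ trans (-1*x≈-x (- 1#)) (-‿involutive 1#) ⟩
        1#                ∎
      q : ℕ
      q = (2 ℕ.* e) ℕ./ N
      2e≡q*N : 2 ℕ.* e ≡ q ℕ.* N
      2e≡q*N = trans (ℕ.m≡m%n+[m/n]*n (2 ℕ.* e) N) (cong (ℕ._+ q ℕ.* N) (trans (α^≡α^⇒%≡% α^2e≡α^0) (ℕ.m*n%n≡0 0 N)))
      q<2 : q < 2
      q<2 = ℕ.m<n*o⇒m/o<n {2 ℕ.* e} {2} {N} (ℕ.*-monoʳ-< 2 (ind<N (- 1#)))
      q≢0 : q ≢ 0
      q≢0 q≡0 = e≢0 (ℕ.m+n≡0⇒m≡0 e (trans 2e≡q*N (cong (ℕ._* N) q≡0)))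
      q≡1 : q ≡ 1
      q≡1 = ℕ.≤-antisym (ℕ.≤-pred q<2) (ℕ.n≢0⇒n>0 q≢0)

  -- k = 0 in characteristic 2, where N is odd and so q n is even; otherwise 2e = N and k = n.
  parity-witness : ∃[ k ] (2 ℕ.* e ≡ m ℕ.* k × (suc N ℕ.* n) % 2 ≡ k % 2)
  parity-witness with 1# + 1# ≟ 0#
  ... | yes 1+1≡0 = 0 , trans (cong (2 ℕ.*_) (e≡0-in-char-2 1+1≡0)) (sym (ℕ.*-zeroʳ m)) , q*n-even
    where
    open ≡-Reasoning
    N%2≡1 : N % 2 ≡ 1
    N%2≡1 with N % 2 | ℕ.m%n<n N 2 | ℕ.m≡m%n+[m/n]*n N 2
    ... | 0           | _            | N≡[N/2]*2 = ⊥-elim (N-odd-in-char-2 1+1≡0 (N ℕ./ 2) (trans N≡[N/2]*2 (ℕ.*-comm (N ℕ./ 2) 2)))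
    ... | 1           | _            | _         = refl
    ... | suc (suc _) | s≤s (s≤s ()) | _
    suc-N≡[1+N/2]*2 : suc N ≡ (1 ℕ.+ N ℕ./ 2) ℕ.* 2
    suc-N≡[1+N/2]*2 = cong suc (trans (ℕ.m≡m%n+[m/n]*n N 2) (cong (ℕ._+ (N ℕ./ 2) ℕ.* 2) N%2≡1))
    q*n-even : (suc N ℕ.* n) % 2 ≡ 0
    q*n-even = begin
      (suc N ℕ.* n) % 2                     ≡⟨ cong (λ s → (s ℕ.* n) % 2) suc-N≡[1+N/2]*2 ⟩
      ((1 ℕ.+ N ℕ./ 2) ℕ.* 2 ℕ.* n) % 2     ≡⟨ cong (_% 2) (ℕ*.xy∙z≈xz∙y (1 ℕ.+ N ℕ./ 2) 2 n) ⟩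
      ((1 ℕ.+ N ℕ./ 2) ℕ.* n ℕ.* 2) % 2     ≡⟨ ℕ.m*n%n≡0 ((1 ℕ.+ N ℕ./ 2) ℕ.* n) 2 ⟩
      0                                     ∎
  ... | no 1+1≢0 = n , 2e≡N-in-odd-char 1+1≢0 , q*n≡n
    where
    open ≡-Reasoning
    q*n≡n : (suc N ℕ.* n) % 2 ≡ n % 2
    q*n≡n = begin
      (suc N ℕ.* n) % 2                   ≡⟨ cong (λ s → (suc s ℕ.* n) % 2) (2e≡N-in-odd-char 1+1≢0) ⟨
      (n ℕ.+ 2 ℕ.* e ℕ.* n) % 2           ≡⟨ cong (λ s → (n ℕ.+ s) % 2) (trans (ℕ.*-assoc 2 e n) (ℕ.*-comm 2 (e ℕ.* n))) ⟩
      (n ℕ.+ (e ℕ.* n) ℕ.* 2) % 2         ≡⟨ ℕ.[m+kn]%n≡m%n n (e ℕ.* n) 2 ⟩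
      n % 2                               ∎

module _ (F : FiniteField) (m : ℕ) (α : FiniteField.Carrier F) where
  CyclotomicPoint : ℤ → ℤ → FiniteField.Carrier F → Set
  CyclotomicPoint a b x = InShiftedPowClass F m α a x × InPowClass F m α b x

  CyclotomicPoint? : ∀ a b → Decidable (CyclotomicPoint a b)
  CyclotomicPoint? a b x = InShiftedPowClass? F m α a x ×-dec InPowClass? F m α b x

Fin-𝒳↔ : ∀ m i j k (F₁ F₂ : FiniteField) α₁ α₂ → Fin (𝒳 m i j k F₁ F₂ α₁ α₂) ↔
  (Σ[ a ∈ Fin m ] Σ[ b ∈ Fin m ]
     (Witness (FiniteField.finType F₁) (CyclotomicPoint? F₁ m α₁ (+ toℕ a) (+ toℕ b)) ×
      Witness (FiniteField.finType F₂) (CyclotomicPoint? F₂ m α₂ (+ toℕ a ℤ.+ i ℤ.- j) (+ toℕ b ℤ.+ i ℤ.- k))))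
Fin-𝒳↔ m i j k F₁ F₂ α₁ α₂ =
  ↔-trans (Fin-sum↔Σ m _ id) (Σ-↔ ↔-refl (λ {a} → ↔-trans (Fin-sum↔Σ m _ id) (Σ-↔ ↔-refl
    (λ {b} → ↔-trans Fin.*↔× (count↔ (FiniteField.finType F₁) (CyclotomicPoint? F₁ m α₁ (+ toℕ a) (+ toℕ b))
                        ×-↔ count↔ (FiniteField.finType F₂) (CyclotomicPoint? F₂ m α₂ (+ toℕ a ℤ.+ i ℤ.- j) (+ toℕ b ℤ.+ i ℤ.- k)))))))

-- Cayley digraphs on GF(q₁) × GF(q₂)

module CayleyDigraph (F₁ F₂ : FiniteField) {S : FinType.Elt (G F₁ F₂) → Set}
                     (S? : Decidable S) where
  private
    module F₁ = FieldProperties F₁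
    module F₂ = FieldProperties F₂

  Γ′ : FinDigraph
  Γ′ = Cay F₁ F₂ S S?

  Elt : Set
  Elt = FinType.Elt (G F₁ F₂)

  infixl 6 _+G′_ _-G_
  _+G′_ : Elt → Elt → Elt
  _+G′_ = _+G_ F₁ F₂

  _-G_ : Elt → Elt → Elt
  (x₁ , x₂) -G (y₁ , y₂) = (x₁ F₁.- y₁) , (x₂ F₂.- y₂)

  [x+y]-y≡x : ∀ x y → (x +G′ y) -G y ≡ x
  [x+y]-y≡x (x₁ , x₂) (y₁ , y₂) = cong₂ _,_
    (F₁.solve 2 (λ x y → (x F₁.:+ y) F₁.:- y F₁.:= x) refl x₁ y₁)
    (F₂.solve 2 (λ x y → (x F₂.:+ y) F₂.:- y F₂.:= x) refl x₂ y₂)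

  [x-y]+y≡x : ∀ x y → (x -G y) +G′ y ≡ x
  [x-y]+y≡x (x₁ , x₂) (y₁ , y₂) = cong₂ _,_
    (F₁.solve 2 (λ x y → (x F₁.:- y) F₁.:+ y F₁.:= x) refl x₁ y₁)
    (F₂.solve 2 (λ x y → (x F₂.:- y) F₂.:+ y F₂.:= x) refl x₂ y₂)

  [z-x]-[y-x]≡z-y : ∀ z x y → (z -G x) -G (y -G x) ≡ z -G y
  [z-x]-[y-x]≡z-y (z₁ , z₂) (x₁ , x₂) (y₁ , y₂) = cong₂ _,_
    (F₁.solve 3 (λ z x y → (z F₁.:- x) F₁.:- (y F₁.:- x) F₁.:= z F₁.:- y) refl z₁ x₁ y₁)
    (F₂.solve 3 (λ z x y → (z F₂.:- x) F₂.:- (y F₂.:- x) F₂.:= z F₂.:- y) refl z₂ x₂ y₂)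

  Adj⇔S[y-x] : ∀ {x y} → FinDigraph.Adj Γ′ x y ⇔ S (y -G x)
  Adj⇔S[y-x] {x} {y} = mk⇔
    (λ (s , Ss , y≡s+x) → subst S (sym (trans (cong (_-G x) y≡s+x) ([x+y]-y≡x s x))) Ss)
    (λ S[y-x] → y -G x , S[y-x] , sym ([x-y]+y≡x y x))

  Both : (Elt → Set) → (Elt → Set) → Elt → Elt → Set
  Both X Y d w = X w × Y (w -G d)

  both? : ∀ {X Y} → Decidable X → Decidable Y → ∀ d → Decidable (Both X Y d)
  both? X? Y? d w = X? w ×-dec Y? (w -G d)

  commonNeighbours≡ : ∀ x y → commonNeighbours Γ′ x y ≡ count (G F₁ F₂) (Both S S (y -G x)) (both? S? S? (y -G x))
  commonNeighbours≡ x y = count-bij (G F₁ F₂) (G F₁ F₂)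
    (λ z → FinDigraph.Adj? Γ′ x z ×-dec FinDigraph.Adj? Γ′ y z) (both? S? S? (y -G x)) (_-G x) (_+G′ x)
    (λ z (x→z , y→z) → Equivalence.to Adj⇔S[y-x] x→z ,
                       subst S (sym ([z-x]-[y-x]≡z-y z x y)) (Equivalence.to Adj⇔S[y-x] y→z))
    (λ w (Sw , S[w-d]) → Equivalence.from Adj⇔S[y-x] (subst S (sym ([x+y]-y≡x w x)) Sw) ,
                         Equivalence.from Adj⇔S[y-x] (subst S ([z-x]-[y-x]≡z-y (w +G′ x) x y)
                                                        (subst (λ v → S (v -G (y -G x))) (sym ([x+y]-y≡x w x)) S[w-d])))
    (λ z _ → [x-y]+y≡x z x) (λ w _ → [x+y]-y≡x w x)

  degree≡ : ∀ x → degree Γ′ x ≡ count (G F₁ F₂) S S?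
  degree≡ x = count-bij (G F₁ F₂) (G F₁ F₂) (FinDigraph.Adj? Γ′ x) S? (_-G x) (_+G′ x)
    (λ z x→z → Equivalence.to Adj⇔S[y-x] x→z)
    (λ w Sw → Equivalence.from Adj⇔S[y-x] (subst S (sym ([x+y]-y≡x w x)) Sw))
    (λ z _ → [x-y]+y≡x z x) (λ w _ → [x+y]-y≡x w x)

-- The graph Γ_m(α₁, α₂)

module Γₘ-Properties (m n₁ n₂ : ℕ) .{{_ : NonZero m}} .{{_ : NonZero n₁}} .{{_ : NonZero n₂}}
    (F₁ F₂ : FiniteField)
    (order₁ : FiniteField.order F₁ ≡ suc (m ℕ.* n₁)) (order₂ : FiniteField.order F₂ ≡ suc (m ℕ.* n₂))
    (α₁ : FiniteField.Carrier F₁) (α₂ : FiniteField.Carrier F₂)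
    (α₁-primitive : FiniteField.IsPrimitive F₁ α₁) (α₂-primitive : FiniteField.IsPrimitive F₂ α₂) where
  module C₁ = CyclotomicClasses F₁ m n₁ order₁ α₁ α₁-primitive
  module C₂ = CyclotomicClasses F₂ m n₂ order₂ α₂ α₂-primitive
  open Congruence m

  S : FinType.Elt (G F₁ F₂) → Set
  S s = InC₁ F₁ F₂ α₁ s ⊎ InD F₁ F₂ m 0 α₁ α₂ s

  S? : Decidable S
  S? s = InC₁? F₁ F₂ α₁ s ⊎-dec InD? F₁ F₂ m 0 α₁ α₂ s

  open CayleyDigraph F₁ F₂ S? public

  -- InC and InD₀ are C₁(α₁) and D₀(α₁, α₂), described through indices.
  InC : Elt → Set
  InC (x₁ , x₂) = x₁ ≢ C₁.0# × x₂ ≡ C₂.0#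

  InC? : Decidable InC
  InC? (x₁ , x₂) = C₁.≢0? x₁ ×-dec x₂ C₂.≟ C₂.0#

  InD₀ : Elt → Set
  InD₀ (x₁ , x₂) = x₁ ≢ C₁.0# × x₂ ≢ C₂.0# × + C₁.ind x₁ ≋ + C₂.ind x₂

  InD₀? : Decidable InD₀
  InD₀? (x₁ , x₂) = C₁.≢0? x₁ ×-dec C₂.≢0? x₂ ×-dec (+ C₁.ind x₁ ≋? + C₂.ind x₂)

  InS : Elt → Set
  InS s = InC s ⊎ InD₀ s

  InS? : Decidable InS
  InS? s = InC? s ⊎-dec InD₀? s

  InC⇒¬InD₀ : ∀ s → InC s → ¬ InD₀ s
  InC⇒¬InD₀ s (_ , x₂≡0) (_ , x₂≢0 , _) = x₂≢0 x₂≡0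

  S⇔InS : ∀ s → S s ⇔ InS s
  S⇔InS (s₁ , s₂) = mk⇔ to from
    where
    to : S (s₁ , s₂) → InS (s₁ , s₂)
    to (inj₁ ((k , α₁^k≡s₁) , s₂≡0)) = inj₁ ((λ s₁≡0 → C₁.α^≢0 (toℕ k) (trans α₁^k≡s₁ s₁≡0)) , s₂≡0)
    to (inj₂ (i₁ , i₂ , i₁≡i₂+0 , α₁^i₁≡s₁ , α₂^i₂≡s₂)) = inj₂
      ((λ s₁≡0 → C₁.α^≢0 (toℕ i₁) (trans α₁^i₁≡s₁ s₁≡0)) ,
       (λ s₂≡0 → C₂.α^≢0 (toℕ i₂) (trans α₂^i₂≡s₂ s₂≡0)) ,
       ≋-trans (C₁.ind-≋ α₁^i₁≡s₁) (≋-trans (Equivalence.to ≡[]ℤ⇔≋ i₁≡i₂+0)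
         (≋-trans (≋-reflexive (ℤ.+-identityʳ (+ toℕ i₂))) (≋-sym (C₂.ind-≋ α₂^i₂≡s₂)))))
    from : InS (s₁ , s₂) → S (s₁ , s₂)
    from (inj₁ (s₁≢0 , s₂≡0)) =
      inj₁ ((C₁.indFin s₁ , trans (cong (α₁ C₁.^_) (C₁.toℕ-indFin s₁)) (C₁.α^ind s₁≢0)) , s₂≡0)
    from (inj₂ (s₁≢0 , s₂≢0 , ind₁≋ind₂)) = inj₂ (C₁.indFin s₁ , C₂.indFin s₂ ,
      Equivalence.from ≡[]ℤ⇔≋ (subst₂ (λ a b → + a ≋ + b ℤ.+ + 0) (sym (C₁.toℕ-indFin s₁)) (sym (C₂.toℕ-indFin s₂))
                                      (≋-trans ind₁≋ind₂ (≋-reflexive (sym (ℤ.+-identityʳ _))))) ,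
      trans (cong (α₁ C₁.^_) (C₁.toℕ-indFin s₁)) (C₁.α^ind s₁≢0) ,
      trans (cong (α₂ C₂.^_) (C₂.toℕ-indFin s₂)) (C₂.α^ind s₂≢0))

  Adj⇔InS[y-x] : ∀ {x y} → FinDigraph.Adj Γ′ x y ⇔ InS (y -G x)
  Adj⇔InS[y-x] = ⇔.trans Adj⇔S[y-x] (S⇔InS _)

  count-both : ∀ {X Y} → Decidable X → Decidable Y → Elt → ℕ
  count-both X? Y? d = count (G F₁ F₂) _ (both? X? Y? d)

  CN : Elt → ℕ
  CN = count-both InS? InS?

  -- CD d counts the w ∈ C₁ with w - d ∈ D₀, and so on.
  CC CD DC DD : Elt → ℕ
  CC = count-both InC? InC?
  CD = count-both InC? InD₀?
  DC = count-both InD₀? InC?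
  DD = count-both InD₀? InD₀?

  commonNeighbours≡CN : ∀ x y → commonNeighbours Γ′ x y ≡ CN (y -G x)
  commonNeighbours≡CN x y = trans (commonNeighbours≡ x y)
    (count-ext (G F₁ F₂) (both? S? S? _) (both? InS? InS? _) (λ w → S⇔InS w ×-⇔ S⇔InS _))

  CN-split : ∀ d → CN d ≡ (CC d ℕ.+ CD d) ℕ.+ (DC d ℕ.+ DD d)
  CN-split d = trans
    (count-⊎ (G F₁ F₂) (both? InS? InS? d) (both? InC? InS? d) (both? InD₀? InS? d)
             (λ _ → ↔⇒⇔ ×-distribʳ-⊎) (λ w (InC-w , _) (InD₀-w , _) → InC⇒¬InD₀ w InC-w InD₀-w))
    (cong₂ ℕ._+_ (split-second InC?) (split-second InD₀?))
    where
    split-second : ∀ {X} (X? : Decidable X) →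
      count-both X? InS? d ≡ count-both X? InC? d ℕ.+ count-both X? InD₀? d
    split-second X? = count-⊎ (G F₁ F₂) (both? X? InS? d) (both? X? InC? d) (both? X? InD₀? d)
      (λ _ → ↔⇒⇔ ×-distribˡ-⊎) (λ w (_ , InC-w-d) (_ , InD₀-w-d) → InC⇒¬InD₀ (w -G d) InC-w-d InD₀-w-d)

  CC[d₁,d₂] : ∀ d₁ {d₂} → d₂ ≢ C₂.0# → CC (d₁ , d₂) ≡ 0
  CC[d₁,d₂] d₁ d₂≢0 = count-≡0 (G F₁ F₂) (both? InC? InC? _)
    (λ (w₁ , w₂) ((_ , w₂≡0) , (_ , w₂-d₂≡0)) → d₂≢0 (trans (sym (C₂.x-y≡0⇒x≡y w₂-d₂≡0)) w₂≡0))

  CC[d₁,0] : ∀ {d₁} → d₁ ≢ C₁.0# → CC (d₁ , C₂.0#) ≡ C₁.N ∸ 1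
  CC[d₁,0] {d₁} d₁≢0 = begin
    CC (d₁ , C₂.0#)
      ≡⟨ count-⊗-graph C₁.finType C₂.finType (both? InC? InC? (d₁ , C₂.0#)) ≢0∖d₁? (λ _ → C₂.0#) (λ _ _ → mk⇔ to from) ⟩
    count C₁.finType _ ≢0∖d₁?                            ≡⟨ cong (_∸ 1) (count-remove C₁.finType C₁.≢0? d₁ d₁≢0) ⟨
    count C₁.finType _ C₁.≢0? ∸ 1                        ≡⟨ cong (_∸ 1) C₁.count-≢0 ⟩
    C₁.N ∸ 1                                             ∎
    where
    open ≡-Reasoning
    ≢0∖d₁? : Decidable (λ x → x ≢ C₁.0# × x ≢ d₁)
    ≢0∖d₁? = λ x → C₁.≢0? x ×-dec ¬? (x C₁.≟ d₁)
    to : ∀ {x y} → Both InC InC (d₁ , C₂.0#) (x , y) → (x ≢ C₁.0# × x ≢ d₁) × y ≡ C₂.0#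
    to ((x≢0 , y≡0) , (x-d₁≢0 , _)) = (x≢0 , x-d₁≢0 ∘ C₁.x≡y⇒x-y≡0) , y≡0
    from : ∀ {x y} → (x ≢ C₁.0# × x ≢ d₁) × y ≡ C₂.0# → Both InC InC (d₁ , C₂.0#) (x , y)
    from ((x≢0 , x≢d₁) , y≡0) = (x≢0 , y≡0) , (C₁.x≢y⇒x-y≢0 x≢d₁ , C₂.x≡y⇒x-y≡0 y≡0)

  CD[d₁,0] : ∀ d₁ → CD (d₁ , C₂.0#) ≡ 0
  CD[d₁,0] d₁ = count-≡0 (G F₁ F₂) (both? InC? InD₀? _)
    (λ (w₁ , w₂) ((_ , w₂≡0) , (_ , w₂-0≢0 , _)) → w₂-0≢0 (C₂.x≡y⇒x-y≡0 w₂≡0))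

  DC[d₁,0] : ∀ d₁ → DC (d₁ , C₂.0#) ≡ 0
  DC[d₁,0] d₁ = count-≡0 (G F₁ F₂) (both? InD₀? InC? _)
    (λ (w₁ , w₂) ((_ , w₂≢0 , _) , (_ , w₂-0≡0)) → w₂≢0 (C₂.x-y≡0⇒x≡y w₂-0≡0))

  CD[d₁,d₂] : ∀ d₁ {d₂} → d₂ ≢ C₂.0# →
          CD (d₁ , d₂) ≡ C₁.count-InClass∖ (+ C₂.ind (C₂.- d₂)) (C₁.- d₁)
  CD[d₁,d₂] d₁ {d₂} d₂≢0 = trans
    (count-⊗-graph C₁.finType C₂.finType (both? InC? InD₀? (d₁ , d₂)) shifted? (λ _ → C₂.0#) (λ _ _ → mk⇔ to from))
    (count-bij C₁.finType C₁.finType shifted? (λ t → C₁.InClass? j t ×-dec ¬? (t C₁.≟ C₁.- d₁)) (C₁._- d₁) (C₁._+ d₁)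
      (λ x (x-d₁∈j , x≢0) → x-d₁∈j ,
                            λ x-d₁≡-d₁ → x≢0 (trans (sym (C₁.[x-y]+y≡x x d₁))
                                                    (trans (cong (C₁._+ d₁) x-d₁≡-d₁) (C₁.-‿inverseˡ d₁))))
      (λ t (t∈j , t≢-d₁) → subst (C₁.InClass j) (sym (C₁.[x+y]-y≡x t d₁)) t∈j ,
                           λ t+d₁≡0 → t≢-d₁ (trans (sym (C₁.[x+y]-y≡x t d₁))
                                                  (trans (cong (C₁._- d₁) t+d₁≡0) (C₁.0-x≡-x d₁))))
      (λ x _ → C₁.[x-y]+y≡x x d₁) (λ t _ → C₁.[x+y]-y≡x t d₁))
    where
    j : ℤ
    j = + C₂.ind (C₂.- d₂)
    shifted? : Decidable (λ x → C₁.InClass j (x C₁.- d₁) × x ≢ C₁.0#)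
    shifted? = λ x → C₁.InClass? j (x C₁.- d₁) ×-dec C₁.≢0? x
    y-d₂≡-d₂ : ∀ {y} → y ≡ C₂.0# → y C₂.- d₂ ≡ C₂.- d₂
    y-d₂≡-d₂ y≡0 = trans (cong (C₂._- d₂) y≡0) (C₂.0-x≡-x d₂)
    to : ∀ {x y} → Both InC InD₀ (d₁ , d₂) (x , y) → (C₁.InClass j (x C₁.- d₁) × x ≢ C₁.0#) × y ≡ C₂.0#
    to ((x≢0 , y≡0) , (x-d₁≢0 , _ , ind≋ind)) = ((x-d₁≢0 , ≋-trans ind≋ind (C₂.ind-cong (y-d₂≡-d₂ y≡0))) , x≢0) , y≡0
    from : ∀ {x y} → (C₁.InClass j (x C₁.- d₁) × x ≢ C₁.0#) × y ≡ C₂.0# → Both InC InD₀ (d₁ , d₂) (x , y)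
    from (((x-d₁≢0 , ind≋j) , x≢0) , y≡0) =
      (x≢0 , y≡0) , (x-d₁≢0 , subst (_≢ C₂.0#) (sym (y-d₂≡-d₂ y≡0)) (C₂.-‿≢0 d₂≢0) ,
                     ≋-trans ind≋j (C₂.ind-cong (sym (y-d₂≡-d₂ y≡0))))

  DC[d₁,d₂] : ∀ d₁ {d₂} → d₂ ≢ C₂.0# → DC (d₁ , d₂) ≡ C₁.count-InClass∖ (+ C₂.ind d₂) d₁
  DC[d₁,d₂] d₁ {d₂} d₂≢0 = count-⊗-graph C₁.finType C₂.finType (both? InD₀? InC? (d₁ , d₂))
    (λ x → C₁.InClass? j x ×-dec ¬? (x C₁.≟ d₁)) (λ _ → d₂) (λ _ _ → mk⇔ to from)
    where
    j : ℤ
    j = + C₂.ind d₂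
    to : ∀ {x y} → Both InD₀ InC (d₁ , d₂) (x , y) → (C₁.InClass j x × x ≢ d₁) × y ≡ d₂
    to ((x≢0 , _ , ind-x≋ind-y) , (x-d₁≢0 , y-d₂≡0)) =
      ((x≢0 , ≋-trans ind-x≋ind-y (C₂.ind-cong (C₂.x-y≡0⇒x≡y y-d₂≡0))) , x-d₁≢0 ∘ C₁.x≡y⇒x-y≡0) ,
      C₂.x-y≡0⇒x≡y y-d₂≡0
    from : ∀ {x y} → (C₁.InClass j x × x ≢ d₁) × y ≡ d₂ → Both InD₀ InC (d₁ , d₂) (x , y)
    from (((x≢0 , ind-x≋j) , x≢d₁) , refl) = (x≢0 , d₂≢0 , ind-x≋j) , (C₁.x≢y⇒x-y≢0 x≢d₁ , C₂.x≡y⇒x-y≡0 refl)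

  DD[d₁,0] : ∀ {d₁} → d₁ ≢ C₁.0# → DD (d₁ , C₂.0#) ≡ (n₁ ∸ 1) ℕ.* n₂
  DD[d₁,0] {d₁} d₁≢0 = trans
    (count-⊗ C₁.finType C₂.finType (both? InD₀? InD₀? (d₁ , C₂.0#))
      (λ x → C₁.≢0? x ×-dec ¬? (x C₁.≟ d₁) ×-dec (+ C₁.ind x ≋? + C₁.ind (x C₁.- d₁)))
      (λ x → C₂.InClass? (+ C₁.ind x)) n₂ (λ _ _ → mk⇔ to from) (λ x _ → C₂.class-size (+ C₁.ind x)))
    (cong (ℕ._* n₂) (C₁.count-ind≋ind[-a] d₁ d₁≢0))
    where
    to : ∀ {x y} → Both InD₀ InD₀ (d₁ , C₂.0#) (x , y) →
         (x ≢ C₁.0# × x ≢ d₁ × + C₁.ind x ≋ + C₁.ind (x C₁.- d₁)) × C₂.InClass (+ C₁.ind x) y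
    to {x} {y} ((x≢0 , y≢0 , ind-x≋ind-y) , (x-d₁≢0 , _ , ind[x-d₁]≋ind[y-0])) =
      (x≢0 , x-d₁≢0 ∘ C₁.x≡y⇒x-y≡0 ,
       ≋-trans ind-x≋ind-y (≋-trans (C₂.ind-cong (sym (C₂.x-0≡x y))) (≋-sym ind[x-d₁]≋ind[y-0]))) ,
      (y≢0 , ≋-sym ind-x≋ind-y)
    from : ∀ {x y} → (x ≢ C₁.0# × x ≢ d₁ × + C₁.ind x ≋ + C₁.ind (x C₁.- d₁)) × C₂.InClass (+ C₁.ind x) y →
           Both InD₀ InD₀ (d₁ , C₂.0#) (x , y)
    from {x} {y} ((x≢0 , x≢d₁ , ind-x≋ind[x-d₁]) , (y≢0 , ind-y≋ind-x)) =
      (x≢0 , y≢0 , ≋-sym ind-y≋ind-x) ,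
      (C₁.x≢y⇒x-y≢0 x≢d₁ , subst (_≢ C₂.0#) (sym (C₂.x-0≡x y)) y≢0 ,
       ≋-trans (≋-sym ind-x≋ind[x-d₁]) (≋-trans (≋-sym ind-y≋ind-x) (C₂.ind-cong (sym (C₂.x-0≡x y)))))

  DD[0,d₂] : ∀ {d₂} → d₂ ≢ C₂.0# → DD (C₁.0# , d₂) ≡ (n₂ ∸ 1) ℕ.* n₁
  DD[0,d₂] {d₂} d₂≢0 = trans (count-⊗-swap C₁.finType C₂.finType (both? InD₀? InD₀? (C₁.0# , d₂))) (trans
    (count-⊗ C₂.finType C₁.finType (both? InD₀? InD₀? (C₁.0# , d₂) ∘ swap)
      (λ y → C₂.≢0? y ×-dec ¬? (y C₂.≟ d₂) ×-dec (+ C₂.ind y ≋? + C₂.ind (y C₂.- d₂)))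
      (λ y → C₁.InClass? (+ C₂.ind y)) n₁ (λ _ _ → mk⇔ to from) (λ y _ → C₁.class-size (+ C₂.ind y)))
    (cong (ℕ._* n₁) (C₂.count-ind≋ind[-a] d₂ d₂≢0)))
    where
    to : ∀ {y x} → Both InD₀ InD₀ (C₁.0# , d₂) (x , y) →
         (y ≢ C₂.0# × y ≢ d₂ × + C₂.ind y ≋ + C₂.ind (y C₂.- d₂)) × C₁.InClass (+ C₂.ind y) x
    to {y} {x} ((x≢0 , y≢0 , ind-x≋ind-y) , (_ , y-d₂≢0 , ind[x-0]≋ind[y-d₂])) =
      (y≢0 , y-d₂≢0 ∘ C₂.x≡y⇒x-y≡0 ,
       ≋-trans (≋-sym ind-x≋ind-y) (≋-trans (C₁.ind-cong (sym (C₁.x-0≡x x))) ind[x-0]≋ind[y-d₂])) ,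
      (x≢0 , ind-x≋ind-y)
    from : ∀ {y x} → (y ≢ C₂.0# × y ≢ d₂ × + C₂.ind y ≋ + C₂.ind (y C₂.- d₂)) × C₁.InClass (+ C₂.ind y) x →
           Both InD₀ InD₀ (C₁.0# , d₂) (x , y)
    from {y} {x} ((y≢0 , y≢d₂ , ind-y≋ind[y-d₂]) , (x≢0 , ind-x≋ind-y)) =
      (x≢0 , y≢0 , ind-x≋ind-y) ,
      (subst (_≢ C₁.0#) (sym (C₁.x-0≡x x)) x≢0 , C₂.x≢y⇒x-y≢0 y≢d₂ ,
       ≋-trans (C₁.ind-cong (C₁.x-0≡x x)) (≋-trans ind-x≋ind-y ind-y≋ind[y-d₂]))

  X : ℕ → ℕ
  X i = 𝒳 m (+ 0) (+ 0) (+ i) F₁ F₂ α₁ α₂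

  module _ (i : ℕ) where
    CyclotomicPair : Elt → Set
    CyclotomicPair (x , y) = (x ≢ C₁.0# × x C₁.- C₁.1# ≢ C₁.0#) × (y ≢ C₂.0# × y C₂.- C₂.1# ≢ C₂.0#) ×
                             + C₁.ind (x C₁.- C₁.1#) ≋ + C₂.ind (y C₂.- C₂.1#) × + C₁.ind x ≋ + C₂.ind y ℤ.+ + i

    CyclotomicPair? : Decidable CyclotomicPair
    CyclotomicPair? (x , y) = (C₁.≢0? x ×-dec C₁.≢0? (x C₁.- C₁.1#)) ×-dec (C₂.≢0? y ×-dec C₂.≢0? (y C₂.- C₂.1#)) ×-dec
                              (+ C₁.ind (x C₁.- C₁.1#) ≋? + C₂.ind (y C₂.- C₂.1#)) ×-dec (+ C₁.ind x ≋? + C₂.ind y ℤ.+ + i)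

    private
      open +-*-Solver using (solve; _:=_; _:+_; _:-_; con)
      a+0-0≡a : ∀ a → + a ℤ.+ + 0 ℤ.- + 0 ≡ + a
      a+0-0≡a a = solve 1 (λ a → a :+ con (+ 0) :- con (+ 0) := a) refl (+ a)
      [b+0-i]+i≡b : ∀ b → (+ b ℤ.+ + 0 ℤ.- + i) ℤ.+ + i ≡ + b
      [b+0-i]+i≡b b = solve 2 (λ b i → (b :+ con (+ 0) :- i) :+ i := b) refl (+ b) (+ i)
      [y+i]-i≡y : ∀ y → (y ℤ.+ + i) ℤ.- + i ≡ y
      [y+i]-i≡y y = solve 2 (λ y i → (y :+ i) :- i := y) refl y (+ i)
      b-i≡b+0-i : ∀ b → + b ℤ.- + i ≡ + b ℤ.+ + 0 ℤ.- + i
      b-i≡b+0-i b = solve 2 (λ b i → b :- i := b :+ con (+ 0) :- i) refl (+ b) (+ i)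
      Classes : Set
      Classes = Σ[ a ∈ Fin m ] Σ[ b ∈ Fin m ]
        (Witness C₁.finType (CyclotomicPoint? F₁ m α₁ (+ toℕ a) (+ toℕ b)) ×
         Witness C₂.finType (CyclotomicPoint? F₂ m α₂ (+ toℕ a ℤ.+ + 0 ℤ.- + 0) (+ toℕ b ℤ.+ + 0 ℤ.- + i)))
      point⇔₁ : ∀ {a b x} → CyclotomicPoint F₁ m α₁ a b x ⇔ (C₁.InClass a (x C₁.- C₁.1#) × C₁.InClass b x)
      point⇔₁ {a} {b} {x} = C₁.InShiftedPowClass⇔InClass {a} {x} ×-⇔ C₁.InPowClass⇔InClass {b} {x}
      point⇔₂ : ∀ {a b y} → CyclotomicPoint F₂ m α₂ a b y ⇔ (C₂.InClass a (y C₂.- C₂.1#) × C₂.InClass b y)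
      point⇔₂ {a} {b} {y} = C₂.InShiftedPowClass⇔InClass {a} {y} ×-⇔ C₂.InPowClass⇔InClass {b} {y}
      pair : ∀ {a b x y} → C₁.InClass (+ a) (x C₁.- C₁.1#) × C₁.InClass (+ b) x →
             C₂.InClass (+ a ℤ.+ + 0 ℤ.- + 0) (y C₂.- C₂.1#) × C₂.InClass (+ b ℤ.+ + 0 ℤ.- + i) y →
             CyclotomicPair (x , y)
      pair {a} {b} ((x-1≢0 , x-1∈a) , (x≢0 , x∈b)) ((y-1≢0 , y-1∈a) , (y≢0 , y∈b-i)) =
        (x≢0 , x-1≢0) , (y≢0 , y-1≢0) ,
        ≋-trans x-1∈a (≋-trans (≋-reflexive (sym (a+0-0≡a a))) (≋-sym y-1∈a)) ,
        ≋-trans x∈b (≋-trans (≋-reflexive (sym ([b+0-i]+i≡b b))) (+-cong (≋-sym y∈b-i) (≋-refl {+ i})))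
      to : Classes → Witness (G F₁ F₂) (CyclotomicPair?)
      to (a , b , (x , px) , (y , py)) = (x , y) , ⇒T-does (CyclotomicPair? (x , y)) (pair
        (Equivalence.to (point⇔₁ {+ toℕ a} {+ toℕ b} {x}) (T-does⇒ (CyclotomicPoint? F₁ m α₁ (+ toℕ a) (+ toℕ b) x) px))
        (Equivalence.to (point⇔₂ {+ toℕ a ℤ.+ + 0 ℤ.- + 0} {+ toℕ b ℤ.+ + 0 ℤ.- + i} {y})
                        (T-does⇒ (CyclotomicPoint? F₂ m α₂ (+ toℕ a ℤ.+ + 0 ℤ.- + 0) (+ toℕ b ℤ.+ + 0 ℤ.- + i) y) py)))
      classes : ∀ x y → CyclotomicPair (x , y) → Classes
      classes x y ((x≢0 , x-1≢0) , (y≢0 , y-1≢0) , x-1≋y-1 , x≋y+i) =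
        a , b , (x , ⇒T-does (CyclotomicPoint? F₁ m α₁ (+ toℕ a) (+ toℕ b) x)
                   (Equivalence.from (point⇔₁ {+ toℕ a} {+ toℕ b} {x}) ((x-1≢0 , x-1∈a) , (x≢0 , x∈b)))) ,
                (y , ⇒T-does (CyclotomicPoint? F₂ m α₂ (+ toℕ a ℤ.+ + 0 ℤ.- + 0) (+ toℕ b ℤ.+ + 0 ℤ.- + i) y)
                   (Equivalence.from (point⇔₂ {+ toℕ a ℤ.+ + 0 ℤ.- + 0} {+ toℕ b ℤ.+ + 0 ℤ.- + i} {y})
                                     ((y-1≢0 , y-1∈a) , (y≢0 , y∈b-i))))
        where
        a b : Fin m
        a = residueFin (+ C₁.ind (x C₁.- C₁.1#))
        b = residueFin (+ C₁.ind x)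
        x-1∈a : + C₁.ind (x C₁.- C₁.1#) ≋ + toℕ a
        x-1∈a = ≋-residueFin (+ C₁.ind (x C₁.- C₁.1#))
        x∈b : + C₁.ind x ≋ + toℕ b
        x∈b = ≋-residueFin (+ C₁.ind x)
        y-1∈a : + C₂.ind (y C₂.- C₂.1#) ≋ + toℕ a ℤ.+ + 0 ℤ.- + 0
        y-1∈a = ≋-trans (≋-sym x-1≋y-1) (≋-trans x-1∈a (≋-reflexive (sym (a+0-0≡a (toℕ a)))))
        y∈b-i : + C₂.ind y ≋ + toℕ b ℤ.+ + 0 ℤ.- + i
        y∈b-i = ≋-trans (≋-reflexive (sym ([y+i]-i≡y _))) (≋-trans (-‿cong (≋-sym x≋y+i) (≋-refl {+ i}))
                  (≋-trans (-‿cong x∈b (≋-refl {+ i})) (≋-reflexive (b-i≡b+0-i (toℕ b)))))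
      from : Witness (G F₁ F₂) (CyclotomicPair?) → Classes
      from ((x , y) , p) = classes x y (T-does⇒ (CyclotomicPair? (x , y)) p)
      to∘from : ∀ w → to (from w) ≡ w
      to∘from _ = witness-≡ refl
      from∘to : ∀ c → from (to c) ≡ c
      from∘to (a , b , (x , px) , (y , py)) = classes-≡ (residueFin-unique x-1∈a) (residueFin-unique x∈b)
        where
        x-point : C₁.InClass (+ toℕ a) (x C₁.- C₁.1#) × C₁.InClass (+ toℕ b) x
        x-point = Equivalence.to (point⇔₁ {+ toℕ a} {+ toℕ b} {x}) (T-does⇒ (CyclotomicPoint? F₁ m α₁ (+ toℕ a) (+ toℕ b) x) px)
        x-1∈a : + C₁.ind (x C₁.- C₁.1#) ≋ + toℕ a
        x-1∈a = proj₂ (proj₁ x-point)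
        x∈b : + C₁.ind x ≋ + toℕ b
        x∈b = proj₂ (proj₂ x-point)
        classes-≡ : ∀ {a′ b′ p′ q′} → a′ ≡ a → b′ ≡ b →
                    _≡_ {A = Classes} (a′ , b′ , (x , p′) , (y , q′)) (a , b , (x , px) , (y , py))
        classes-≡ refl refl = cong₂ (λ p q → a , b , (x , p) , (y , q)) (T-irrelevant _ _) (T-irrelevant _ _)
      classes↔pairs : Classes ↔ Witness (G F₁ F₂) CyclotomicPair?
      classes↔pairs = mk↔ₛ′ to from to∘from from∘to

    -- A pair (x, y) is counted in the summand of 𝒳 indexed by the classes of x - 1 and x.
    count-CyclotomicPair : count (G F₁ F₂) CyclotomicPair CyclotomicPair? ≡ X i
    count-CyclotomicPair = count-is (G F₁ F₂) CyclotomicPair?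
      (↔-trans (↔-sym classes↔pairs) (↔-sym (Fin-𝒳↔ m (+ 0) (+ 0) (+ i) F₁ F₂ α₁ α₂)))

  module _ {d₁ d₂} (d₁≢0 : d₁ ≢ C₁.0#) (d₂≢0 : d₂ ≢ C₂.0#) (e₁≋e₂ : + C₁.e ≋ + C₂.e)
           (i : ℕ) (d₁-d₂≋i : + C₁.ind d₁ ℤ.- + C₂.ind d₂ ≋ + i) where

    private
      open +-*-Solver using (solve; _:=_; _:+_; _:-_)
      D₁ D₂ : ℤ
      D₁ = + C₁.ind d₁
      D₂ = + C₂.ind d₂
      invert : Elt → Elt
      invert (w₁ , w₂) = d₁ C₁./ w₁ , d₂ C₂./ w₂
      invert-involutive : ∀ w → proj₁ w ≢ C₁.0# × proj₂ w ≢ C₂.0# → invert (invert w) ≡ w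
      invert-involutive (w₁ , w₂) (w₁≢0 , w₂≢0) = cong₂ _,_ (C₁.x/[x/y]≡y d₁≢0 w₁≢0) (C₂.x/[x/y]≡y d₂≢0 w₂≢0)
      nonzero : ∀ {w} → Both InD₀ InD₀ (d₁ , d₂) w → proj₁ w ≢ C₁.0# × proj₂ w ≢ C₂.0#
      nonzero ((w₁≢0 , w₂≢0 , _) , _) = w₁≢0 , w₂≢0
      nonzero′ : ∀ {w} → CyclotomicPair i w → proj₁ w ≢ C₁.0# × proj₂ w ≢ C₂.0#
      nonzero′ ((x≢0 , _) , (y≢0 , _) , _) = x≢0 , y≢0
      maps-to : ∀ w → Both InD₀ InD₀ (d₁ , d₂) w → CyclotomicPair i (invert w)
      maps-to (w₁ , w₂) ((w₁≢0 , w₂≢0 , W₁≋W₂) , (w₁-d₁≢0 , w₂-d₂≢0 , V₁≋V₂)) =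
        (C₁.x/y≢0 d₁≢0 w₁≢0 , C₁.x≢y⇒x-y≢0 (C₁.x/y≢1 d₁≢0 w₁≢d₁)) ,
        (C₂.x/y≢0 d₂≢0 w₂≢0 , C₂.x≢y⇒x-y≢0 (C₂.x/y≢1 d₂≢0 w₂≢d₂)) ,
        ≋-trans (C₁.ind-/-1 w₁≢0 w₁≢d₁)
          (≋-trans (-‿cong (+-cong e₁≋e₂ V₁≋V₂) W₁≋W₂) (≋-sym (C₂.ind-/-1 w₂≢0 w₂≢d₂))) ,
        ≋-trans (C₁.ind-/ d₁≢0 w₁≢0)
          (≋-trans (≋-reflexive (solve 3 (λ a b w → a :- w := (b :- w) :+ (a :- b)) refl D₁ D₂ (+ C₁.ind w₁)))
          (+-cong (≋-trans (-‿cong (≋-refl {D₂}) W₁≋W₂) (≋-sym (C₂.ind-/ d₂≢0 w₂≢0))) d₁-d₂≋i))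
        where
        w₁≢d₁ : w₁ ≢ d₁
        w₁≢d₁ = w₁-d₁≢0 ∘ C₁.x≡y⇒x-y≡0
        w₂≢d₂ : w₂ ≢ d₂
        w₂≢d₂ = w₂-d₂≢0 ∘ C₂.x≡y⇒x-y≡0
      maps-from : ∀ w → CyclotomicPair i w → Both InD₀ InD₀ (d₁ , d₂) (invert w)
      maps-from (x , y) ((x≢0 , x-1≢0) , (y≢0 , y-1≢0) , X′≋Y′ , X≋Y+i) =
        (w₁≢0 , w₂≢0 , W₁≋W₂) ,
        (C₁.x≢y⇒x-y≢0 w₁≢d₁ , C₂.x≢y⇒x-y≢0 w₂≢d₂ ,
         ≋-trans (≋-isolate {c = + C₁.ind w₁} {e = + C₁.e} X′≋e₁+V₁-W₁)
           (≋-trans (+-cong (-‿cong X′≋Y′ e₁≋e₂) W₁≋W₂)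
                    (≋-sym (≋-isolate {c = + C₂.ind w₂} {e = + C₂.e} Y′≋e₂+V₂-W₂))))
        where
        w₁ : C₁.Carrier
        w₁ = d₁ C₁./ x
        w₂ : C₂.Carrier
        w₂ = d₂ C₂./ y
        w₁≢0 : w₁ ≢ C₁.0#
        w₁≢0 = C₁.x/y≢0 d₁≢0 x≢0
        w₂≢0 : w₂ ≢ C₂.0#
        w₂≢0 = C₂.x/y≢0 d₂≢0 y≢0
        w₁≢d₁ : w₁ ≢ d₁
        w₁≢d₁ = C₁.x/y≢x d₁≢0 x≢0 (x-1≢0 ∘ C₁.x≡y⇒x-y≡0)
        w₂≢d₂ : w₂ ≢ d₂
        w₂≢d₂ = C₂.x/y≢x d₂≢0 y≢0 (y-1≢0 ∘ C₂.x≡y⇒x-y≡0)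
        W₁≋W₂ : + C₁.ind (d₁ C₁./ x) ≋ + C₂.ind (d₂ C₂./ y)
        W₁≋W₂ = ≋-trans (C₁.ind-/ d₁≢0 x≢0)
                  (≋-trans (-‿cong (≋-refl {D₁}) (≋-trans X≋Y+i (+-cong (≋-refl {+ C₂.ind y}) (≋-sym d₁-d₂≋i))))
                  (≋-trans (≋-reflexive (solve 3 (λ a b y → a :- (y :+ (a :- b)) := b :- y) refl D₁ D₂ (+ C₂.ind y)))
                    (≋-sym (C₂.ind-/ d₂≢0 y≢0))))
        X′≋e₁+V₁-W₁ : + C₁.ind (x C₁.- C₁.1#) ≋ (+ C₁.e ℤ.+ + C₁.ind (w₁ C₁.- d₁)) ℤ.- + C₁.ind w₁
        X′≋e₁+V₁-W₁ = subst (λ z → + C₁.ind (z C₁.- C₁.1#) ≋ (+ C₁.e ℤ.+ + C₁.ind (w₁ C₁.- d₁)) ℤ.- + C₁.ind w₁)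
                            (C₁.x/[x/y]≡y d₁≢0 x≢0) (C₁.ind-/-1 w₁≢0 w₁≢d₁)
        Y′≋e₂+V₂-W₂ : + C₂.ind (y C₂.- C₂.1#) ≋ (+ C₂.e ℤ.+ + C₂.ind (w₂ C₂.- d₂)) ℤ.- + C₂.ind w₂
        Y′≋e₂+V₂-W₂ = subst (λ z → + C₂.ind (z C₂.- C₂.1#) ≋ (+ C₂.e ℤ.+ + C₂.ind (w₂ C₂.- d₂)) ℤ.- + C₂.ind w₂)
                            (C₂.x/[x/y]≡y d₂≢0 y≢0) (C₂.ind-/-1 w₂≢0 w₂≢d₂)

    -- w ↦ (d₁/w₁, d₂/w₂) is an involution taking these w onto the cyclotomic pairs.
    DD[d₁,d₂] : DD (d₁ , d₂) ≡ X i
    DD[d₁,d₂] = trans (count-bij (G F₁ F₂) (G F₁ F₂) (both? InD₀? InD₀? (d₁ , d₂)) (CyclotomicPair? i)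
                             invert invert maps-to maps-from (λ w p → invert-involutive w (nonzero p))
                             (λ w p → invert-involutive w (nonzero′ p)))
                  (count-CyclotomicPair i)

  CN[d₁,0] : ∀ {d₁} → d₁ ≢ C₁.0# → CN (d₁ , C₂.0#) ≡ (C₁.N ∸ 1) ℕ.+ (n₁ ∸ 1) ℕ.* n₂
  CN[d₁,0] {d₁} d₁≢0 = trans (CN-split _) (trans
    (cong₂ ℕ._+_ (cong₂ ℕ._+_ (CC[d₁,0] d₁≢0) (CD[d₁,0] d₁)) (cong₂ ℕ._+_ (DC[d₁,0] d₁) (DD[d₁,0] d₁≢0)))
    (cong (ℕ._+ (n₁ ∸ 1) ℕ.* n₂) (ℕ.+-identityʳ (C₁.N ∸ 1))))

  CN[0,d₂] : ∀ {d₂} → d₂ ≢ C₂.0# → CN (C₁.0# , d₂) ≡ n₁ ℕ.* (n₂ ℕ.+ 1)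
  CN[0,d₂] {d₂} d₂≢0 = trans (CN-split _) (trans
    (cong₂ ℕ._+_ (cong₂ ℕ._+_ (CC[d₁,d₂] C₁.0# d₂≢0) (trans (CD[d₁,d₂] C₁.0# d₂≢0) (C₁.count-InClass∖-∉ _ _ -0∉)))
                 (cong₂ ℕ._+_ (trans (DC[d₁,d₂] C₁.0# d₂≢0) (C₁.count-InClass∖-∉ (+ C₂.ind d₂) C₁.0# (λ (0≢0 , _) → 0≢0 refl)))
                              (DD[0,d₂] d₂≢0)))
    (arithmetic n₁ n₂))
    where
    -0∉ : ¬ C₁.InClass (+ C₂.ind (C₂.- d₂)) (C₁.- C₁.0#)
    -0∉ (-0≢0 , _) = -0≢0 C₁.-0#≈0#
    arithmetic : ∀ a k .{{_ : NonZero k}} → a ℕ.+ (a ℕ.+ (k ∸ 1) ℕ.* a) ≡ a ℕ.* (k ℕ.+ 1)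
    arithmetic a (suc j) = solve 2 (λ a j → a :+ (a :+ j :* a) := a :* ((con 1 :+ j) :+ con 1)) refl a j
      where open ℕ-Solver.+-*-Solver using (solve; _:=_; _:+_; _:*_; con)

  module _ {d₁ d₂} (d₁≢0 : d₁ ≢ C₁.0#) (d₂≢0 : d₂ ≢ C₂.0#) (e₁≋e₂ : + C₁.e ≋ + C₂.e) where
    -d₁∈[-d₂]⇔d₁∈[d₂] : C₁.InClass (+ C₂.ind (C₂.- d₂)) (C₁.- d₁) ⇔ C₁.InClass (+ C₂.ind d₂) d₁
    -d₁∈[-d₂]⇔d₁∈[d₂] = mk⇔
      (λ (_ , ind[-d₁]≋ind[-d₂]) → d₁≢0 ,
        +-cancelˡ e₁≋e₂ (≋-trans (≋-sym (C₁.ind-neg d₁≢0)) (≋-trans ind[-d₁]≋ind[-d₂] (C₂.ind-neg d₂≢0))))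
      (λ (_ , ind-d₁≋ind-d₂) → C₁.-‿≢0 d₁≢0 ,
        ≋-trans (C₁.ind-neg d₁≢0) (≋-trans (+-cong e₁≋e₂ ind-d₁≋ind-d₂) (≋-sym (C₂.ind-neg d₂≢0))))

    CN-D₀ : + C₁.ind d₁ ≋ + C₂.ind d₂ → CN (d₁ , d₂) ≡ (n₁ ∸ 1) ℕ.+ ((n₁ ∸ 1) ℕ.+ X 0)
    CN-D₀ ind-d₁≋ind-d₂ = trans (CN-split _)
      (cong₂ ℕ._+_ (cong₂ ℕ._+_ (CC[d₁,d₂] d₁ d₂≢0)
                                (trans (CD[d₁,d₂] d₁ d₂≢0) (C₁.count-InClass∖-∈ (Equivalence.from -d₁∈[-d₂]⇔d₁∈[d₂] d₁∈[d₂]))))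
                   (cong₂ ℕ._+_ (trans (DC[d₁,d₂] d₁ d₂≢0) (C₁.count-InClass∖-∈ d₁∈[d₂]))
                                (DD[d₁,d₂] d₁≢0 d₂≢0 e₁≋e₂ 0 (Equivalence.to ≋⇔-≋0 ind-d₁≋ind-d₂))))
      where
      d₁∈[d₂] : C₁.InClass (+ C₂.ind d₂) d₁
      d₁∈[d₂] = d₁≢0 , ind-d₁≋ind-d₂

    CN-∉D₀ : ¬ (+ C₁.ind d₁ ≋ + C₂.ind d₂) → ∀ i → + C₁.ind d₁ ℤ.- + C₂.ind d₂ ≋ + i →
             CN (d₁ , d₂) ≡ n₁ ℕ.+ (n₁ ℕ.+ X i)
    CN-∉D₀ ind-d₁≉ind-d₂ i d₁-d₂≋i = trans (CN-split _)
      (cong₂ ℕ._+_ (cong₂ ℕ._+_ (CC[d₁,d₂] d₁ d₂≢0)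
                                (trans (CD[d₁,d₂] d₁ d₂≢0) (C₁.count-InClass∖-∉ _ _ (d₁∉[d₂] ∘ Equivalence.to -d₁∈[-d₂]⇔d₁∈[d₂]))))
                   (cong₂ ℕ._+_ (trans (DC[d₁,d₂] d₁ d₂≢0) (C₁.count-InClass∖-∉ _ _ d₁∉[d₂]))
                                (DD[d₁,d₂] d₁≢0 d₂≢0 e₁≋e₂ i d₁-d₂≋i)))
      where
      d₁∉[d₂] : ¬ C₁.InClass (+ C₂.ind d₂) d₁
      d₁∉[d₂] = ind-d₁≉ind-d₂ ∘ proj₂

  private
    Adj : Elt → Elt → Set
    Adj = FinDigraph.Adj Γ′

  0G 1G 1₀ : Elt
  0G = C₁.0# , C₂.0#
  1G = C₁.1# , C₂.1#
  1₀ = C₁.1# , C₂.0#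

  1-0≢0₁ : C₁.1# C₁.- C₁.0# ≢ C₁.0#
  1-0≢0₁ = subst (_≢ C₁.0#) (sym (C₁.x-0≡x C₁.1#)) C₁.1≢0

  1-0≢0₂ : C₂.1# C₂.- C₂.0# ≢ C₂.0#
  1-0≢0₂ = subst (_≢ C₂.0#) (sym (C₂.x-0≡x C₂.1#)) C₂.1≢0

  InC[1₀-0] : InC (1₀ -G 0G)
  InC[1₀-0] = 1-0≢0₁ , C₂.-‿inverseʳ C₂.0#

  InD₀[1-0] : InD₀ (1G -G 0G)
  InD₀[1-0] = 1-0≢0₁ , 1-0≢0₂ ,
    ≋-trans (C₁.ind-cong (C₁.x-0≡x C₁.1#))
            (≋-trans (≋-reflexive (cong +_ (trans C₁.ind-1 (sym C₂.ind-1)))) (C₂.ind-cong (sym (C₂.x-0≡x C₂.1#))))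

  0→1 : Adj 0G 1G
  0→1 = Equivalence.from Adj⇔InS[y-x] (inj₂ InD₀[1-0])

  0→1₀ : Adj 0G 1₀
  0→1₀ = Equivalence.from Adj⇔InS[y-x] (inj₁ InC[1₀-0])

  -[y-x]≡x-y : ∀ x y → ((C₁.- proj₁ (y -G x)) , (C₂.- proj₂ (y -G x))) ≡ x -G y
  -[y-x]≡x-y (x₁ , x₂) (y₁ , y₂) = cong₂ _,_
    (C₁.solve 2 (λ x y → C₁.:- (y C₁.:- x) C₁.:= x C₁.:- y) refl x₁ y₁)
    (C₂.solve 2 (λ x y → C₂.:- (y C₂.:- x) C₂.:= x C₂.:- y) refl x₂ y₂)

  InS-neg : + C₁.e ≋ + C₂.e → ∀ {s₁ s₂} → InS (s₁ , s₂) → InS (C₁.- s₁ , C₂.- s₂)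
  InS-neg _ (inj₁ (s₁≢0 , s₂≡0)) = inj₁ (C₁.-‿≢0 s₁≢0 , trans (cong C₂.-_ s₂≡0) C₂.-0#≈0#)
  InS-neg e₁≋e₂ (inj₂ (s₁≢0 , s₂≢0 , ind-s₁≋ind-s₂)) = inj₂ (C₁.-‿≢0 s₁≢0 , C₂.-‿≢0 s₂≢0 ,
    ≋-trans (C₁.ind-neg s₁≢0) (≋-trans (+-cong e₁≋e₂ ind-s₁≋ind-s₂) (≋-sym (C₂.ind-neg s₂≢0))))

  symmetric : + C₁.e ≋ + C₂.e → ∀ x y → Adj x y → Adj y x
  symmetric e₁≋e₂ x y x→y = Equivalence.from Adj⇔InS[y-x]
    (subst InS (-[y-x]≡x-y x y) (InS-neg e₁≋e₂ (Equivalence.to Adj⇔InS[y-x] x→y)))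

  symmetric⇒e₁≋e₂ : (∀ x y → Adj x y → Adj y x) → + C₁.e ≋ + C₂.e
  symmetric⇒e₁≋e₂ sym-Adj = from-InS (Equivalence.to Adj⇔InS[y-x] (sym-Adj 0G 1G 0→1))
    where
    from-InS : InS (0G -G 1G) → + C₁.e ≋ + C₂.e
    from-InS (inj₁ (_ , 0-1≡0))              = ⊥-elim (C₂.-‿≢0 C₂.1≢0 (trans (sym (C₂.0-x≡-x C₂.1#)) 0-1≡0))
    from-InS (inj₂ (_ , _ , ind[0-1]≋ind[0-1])) =
      ≋-trans (C₁.ind-cong (sym (C₁.0-x≡-x C₁.1#))) (≋-trans ind[0-1]≋ind[0-1] (C₂.ind-cong (C₂.0-x≡-x C₂.1#)))

  first-≢0 : ∀ {s} → InS s → proj₁ s ≢ C₁.0#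
  first-≢0 (inj₁ (s₁≢0 , _))     = s₁≢0
  first-≢0 (inj₂ (s₁≢0 , _ , _)) = s₁≢0

  irreflexive : ∀ x → ¬ Adj x x
  irreflexive (x₁ , x₂) x→x = first-≢0 (Equivalence.to Adj⇔InS[y-x] x→x) (C₁.-‿inverseʳ x₁)

  non-complete : IsNonComplete Γ′
  non-complete = 0G , (C₁.0# , C₂.1#) , (λ 0G≡ → C₂.1≢0 (sym (cong proj₂ 0G≡))) , not-adjacent
    where
    not-adjacent : ¬ Adj 0G (C₁.0# , C₂.1#)
    not-adjacent 0→ = first-≢0 (Equivalence.to Adj⇔InS[y-x] 0→) (C₁.-‿inverseʳ C₁.0#)

  count-InS : count (G F₁ F₂) InS InS? ≡ C₁.N ℕ.+ C₁.N ℕ.* n₂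
  count-InS = trans (count-⊎ (G F₁ F₂) InS? InC? InD₀? (λ _ → ⇔.refl) InC⇒¬InD₀) (cong₂ ℕ._+_ count-InC count-InD₀)
    where
    count-InC : count (G F₁ F₂) InC InC? ≡ C₁.N
    count-InC = trans (count-⊗-graph C₁.finType C₂.finType InC? C₁.≢0? (λ _ → C₂.0#) (λ _ _ → ⇔.refl)) C₁.count-≢0
    count-InD₀ : count (G F₁ F₂) InD₀ InD₀? ≡ C₁.N ℕ.* n₂
    count-InD₀ = trans
      (count-⊗ C₁.finType C₂.finType InD₀? C₁.≢0? (λ x → C₂.InClass? (+ C₁.ind x)) n₂
        (λ _ _ → mk⇔ (λ (x≢0 , y≢0 , ind-x≋ind-y) → x≢0 , y≢0 , ≋-sym ind-x≋ind-y)
                     (λ (x≢0 , y≢0 , ind-y≋ind-x) → x≢0 , y≢0 , ≋-sym ind-y≋ind-x))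
        (λ x _ → C₂.class-size (+ C₁.ind x)))
      (cong (ℕ._* n₂) C₁.count-≢0)

  degree-Γ : ∀ x → degree Γ′ x ≡ C₁.N ℕ.* (n₂ ℕ.+ 1)
  degree-Γ x = trans (degree≡ x) (trans (count-ext (G F₁ F₂) S? InS? S⇔InS) (trans count-InS
    (trans (sym (ℕ.*-suc C₁.N n₂)) (cong (C₁.N ℕ.*_) (ℕ.+-comm 1 n₂)))))

  InC-clique : Elt → Bool
  InC-clique (_ , y) = does (y C₂.≟ C₂.0#)

  InC-clique⇔ : ∀ {y} → does (y C₂.≟ C₂.0#) ≡ true ⇔ y ≡ C₂.0#
  InC-clique⇔ {y} = mk⇔ (does≡true⇒ (y C₂.≟ C₂.0#)) (dec-true (y C₂.≟ C₂.0#))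

  InC-clique-isClique : IsClique Γ′ InC-clique
  InC-clique-isClique (x₁ , x₂) (y₁ , y₂) x∈ y∈ x≢y = Equivalence.from Adj⇔InS[y-x]
    (inj₁ (C₁.x≢y⇒x-y≢0 (λ y₁≡x₁ → x≢y (cong₂ _,_ (sym y₁≡x₁) (trans x₂≡0 (sym y₂≡0)))) ,
           C₂.x≡y⇒x-y≡0 (trans y₂≡0 (sym x₂≡0))))
    where
    x₂≡0 : x₂ ≡ C₂.0#
    x₂≡0 = Equivalence.to InC-clique⇔ x∈
    y₂≡0 : y₂ ≡ C₂.0#
    y₂≡0 = Equivalence.to InC-clique⇔ y∈

  InC-clique-order : cliqueOrder Γ′ InC-clique ≡ suc C₁.N
  InC-clique-order = trans
    (count-⊗-graph C₁.finType C₂.finType (λ y → InC-clique y Bool.≟ true) (λ _ → yes tt) (λ _ → C₂.0#)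
      (λ _ _ → mk⇔ (λ y∈ → tt , Equivalence.to InC-clique⇔ y∈) (Equivalence.from InC-clique⇔ ∘ proj₂)))
    (trans (count-all C₁.finType) order₁)

  InC-clique-regular : ∀ x → InC-clique x ≡ false →
    count (G F₁ F₂) (λ y → InC-clique y ≡ true × Adj x y) (λ y → (InC-clique y Bool.≟ true) ×-dec FinDigraph.Adj? Γ′ x y) ≡ n₁
  InC-clique-regular (x₁ , x₂) x∉ = trans
    (count-⊗-graph C₁.finType C₂.finType (λ y → (InC-clique y Bool.≟ true) ×-dec FinDigraph.Adj? Γ′ (x₁ , x₂) y)
      (λ y₁ → C₁.InClass? j (y₁ C₁.- x₁)) (λ _ → C₂.0#) (λ _ _ → mk⇔ to from))
    (trans (count-bij C₁.finType C₁.finType (λ y₁ → C₁.InClass? j (y₁ C₁.- x₁)) (C₁.InClass? j) (C₁._- x₁) (C₁._+ x₁)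
             (λ _ → id) (λ t t∈j → subst (C₁.InClass j) (sym (C₁.[x+y]-y≡x t x₁)) t∈j)
             (λ y₁ _ → C₁.[x-y]+y≡x y₁ x₁) (λ t _ → C₁.[x+y]-y≡x t x₁))
           (C₁.class-size j))
    where
    j : ℤ
    j = + C₂.ind (C₂.- x₂)
    x₂≢0 : x₂ ≢ C₂.0#
    x₂≢0 x₂≡0 = not-¬ (Equivalence.from InC-clique⇔ x₂≡0) x∉
    0-x₂≡-x₂ : ∀ {y₂} → y₂ ≡ C₂.0# → y₂ C₂.- x₂ ≡ C₂.- x₂
    0-x₂≡-x₂ y₂≡0 = trans (cong (C₂._- x₂) y₂≡0) (C₂.0-x≡-x x₂)
    to : ∀ {y₁ y₂} → InC-clique (y₁ , y₂) ≡ true × Adj (x₁ , x₂) (y₁ , y₂) →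
         C₁.InClass j (y₁ C₁.- x₁) × y₂ ≡ C₂.0#
    to {y₁} {y₂} (y∈ , x→y) = from-InS (Equivalence.to Adj⇔InS[y-x] x→y) , y₂≡0
      where
      y₂≡0 : y₂ ≡ C₂.0#
      y₂≡0 = Equivalence.to InC-clique⇔ y∈
      from-InS : InS ((y₁ , y₂) -G (x₁ , x₂)) → C₁.InClass j (y₁ C₁.- x₁)
      from-InS (inj₁ (_ , y₂-x₂≡0))          = ⊥-elim (C₂.-‿≢0 x₂≢0 (trans (sym (0-x₂≡-x₂ y₂≡0)) y₂-x₂≡0))
      from-InS (inj₂ (y₁-x₁≢0 , _ , ind≋ind)) = y₁-x₁≢0 , ≋-trans ind≋ind (C₂.ind-cong (0-x₂≡-x₂ y₂≡0))
    from : ∀ {y₁ y₂} → C₁.InClass j (y₁ C₁.- x₁) × y₂ ≡ C₂.0# →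
           InC-clique (y₁ , y₂) ≡ true × Adj (x₁ , x₂) (y₁ , y₂)
    from ((y₁-x₁≢0 , ind≋j) , y₂≡0) = Equivalence.from InC-clique⇔ y₂≡0 ,
      Equivalence.from Adj⇔InS[y-x] (inj₂ (y₁-x₁≢0 , subst (_≢ C₂.0#) (sym (0-x₂≡-x₂ y₂≡0)) (C₂.-‿≢0 x₂≢0) ,
                                            ≋-trans ind≋j (C₂.ind-cong (sym (0-x₂≡-x₂ y₂≡0)))))

  λ-C λ-D : ℕ
  λ-C = (C₁.N ∸ 1) ℕ.+ (n₁ ∸ 1) ℕ.* n₂
  λ-D = (n₁ ∸ 1) ℕ.+ ((n₁ ∸ 1) ℕ.+ X 0)

  CN-InC : ∀ {d} → InC d → CN d ≡ λ-C
  CN-InC (d₁≢0 , refl) = CN[d₁,0] d₁≢0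

  CN-InD₀ : + C₁.e ≋ + C₂.e → ∀ {d} → InD₀ d → CN d ≡ λ-D
  CN-InD₀ e₁≋e₂ (d₁≢0 , d₂≢0 , ind-d₁≋ind-d₂) = CN-D₀ d₁≢0 d₂≢0 e₁≋e₂ ind-d₁≋ind-d₂

  e₁≋e₂⇔parity : (+ C₁.e ≋ + C₂.e) ⇔ ((suc C₁.N ℕ.* n₁) % 2 ≡ (suc C₂.N ℕ.* n₂) % 2)
  e₁≋e₂⇔parity =
    let (k₁ , 2e₁≡mk₁ , q₁n₁≡k₁) = C₁.parity-witness
        (k₂ , 2e₂≡mk₂ , q₂n₂≡k₂) = C₂.parity-witness
    in ⇔.trans (halves-≋⇔parity m 2e₁≡mk₁ 2e₂≡mk₂)
               (mk⇔ (λ k₁≡k₂ → trans q₁n₁≡k₁ (trans k₁≡k₂ (sym q₂n₂≡k₂)))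
                    (λ q₁n₁≡q₂n₂ → trans (sym q₁n₁≡k₁) (trans q₁n₁≡q₂n₂ q₂n₂≡k₂)))

  Neumaier⇒e₁≋e₂×λ-C≡λ-D : IsNeumaier Γ′ → + C₁.e ≋ + C₂.e × λ-C ≡ λ-D
  Neumaier⇒e₁≋e₂×λ-C≡λ-D ((sym-Adj , _) , _ , (_ , _ , λ′ , (_ , _ , edge-λ)) , _) = e₁≋e₂ , (begin
    λ-C                            ≡⟨ CN-InC InC[1₀-0] ⟨
    CN (1₀ -G 0G)                  ≡⟨ commonNeighbours≡CN 0G 1₀ ⟨
    commonNeighbours Γ′ 0G 1₀      ≡⟨ edge-λ 0G 1₀ 0→1₀ ⟩
    λ′                             ≡⟨ edge-λ 0G 1G 0→1 ⟨
    commonNeighbours Γ′ 0G 1G      ≡⟨ commonNeighbours≡CN 0G 1G ⟩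
    CN (1G -G 0G)                  ≡⟨ CN-InD₀ e₁≋e₂ InD₀[1-0] ⟩
    λ-D                            ∎)
    where
    open ≡-Reasoning
    e₁≋e₂ : + C₁.e ≋ + C₂.e
    e₁≋e₂ = symmetric⇒e₁≋e₂ sym-Adj

  Neumaier-with-parameters : + C₁.e ≋ + C₂.e → λ-C ≡ λ-D →
    IsNeumaierWithParams Γ′ (suc C₁.N ℕ.* suc C₂.N) (C₁.N ℕ.* (n₂ ℕ.+ 1)) λ-C n₁ (suc C₁.N)
  Neumaier-with-parameters e₁≋e₂ λ-C≡λ-D =
    (symmetric e₁≋e₂ , irreflexive) , non-complete ,
    (cong₂ ℕ._*_ order₁ order₂ , degree-Γ , edge-λ) ,
    (InC-clique , (InC-clique-isClique , ℕ.>-nonZero⁻¹ n₁ , InC-clique-regular) , InC-clique-order)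
    where
    edge-λ : ∀ x y → Adj x y → commonNeighbours Γ′ x y ≡ λ-C
    edge-λ x y x→y = trans (commonNeighbours≡CN x y)
      ([ CN-InC , (λ d∈D₀ → trans (CN-InD₀ e₁≋e₂ d∈D₀) (sym λ-C≡λ-D)) ] (Equivalence.to Adj⇔InS[y-x] x→y))

  module _ (e₁≋e₂ : + C₁.e ≋ + C₂.e) where
    CN-∉S-≢0 : ∀ {d₁ d₂} → d₁ ≢ C₁.0# → d₂ ≢ C₂.0# →
               Dec (+ C₁.ind d₁ ≋ + C₂.ind d₂) → ¬ InS (d₁ , d₂) →
               ∃[ i ] ((1 ≤ i × i < m) × CN (d₁ , d₂) ≡ 2 ℕ.* n₁ ℕ.+ X i)
    CN-∉S-≢0 d₁≢0 d₂≢0 (yes ind-d₁≋ind-d₂) d∉S = ⊥-elim (d∉S (inj₂ (d₁≢0 , d₂≢0 , ind-d₁≋ind-d₂)))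
    CN-∉S-≢0 {d₁} {d₂} d₁≢0 d₂≢0 (no ind-d₁≉ind-d₂) _ = i , (1≤i , residue<m δ) ,
      trans (CN-∉D₀ d₁≢0 d₂≢0 e₁≋e₂ ind-d₁≉ind-d₂ i (≋-residue δ))
            (trans (sym (ℕ.+-assoc n₁ n₁ (X i))) (cong (λ k → n₁ ℕ.+ k ℕ.+ X i) (sym (ℕ.+-identityʳ n₁))))
      where
      δ : ℤ
      δ = + C₁.ind d₁ ℤ.- + C₂.ind d₂
      i : ℕ
      i = residue δ
      1≤i : 1 ≤ i
      1≤i = ℕ.n≢0⇒n>0 (λ i≡0 →
        ind-d₁≉ind-d₂ (Equivalence.from ≋⇔-≋0 (≋-trans (≋-residue δ) (≋-reflexive (cong +_ i≡0)))))

    CN-∉S : ∀ d₁ d₂ → Dec (d₁ ≡ C₁.0#) → Dec (d₂ ≡ C₂.0#) → (d₁ , d₂) ≢ 0G → ¬ InS (d₁ , d₂) →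
            (CN (d₁ , d₂) ≡ n₁ ℕ.* (n₂ ℕ.+ 1)) ⊎ (∃[ i ] ((1 ≤ i × i < m) × CN (d₁ , d₂) ≡ 2 ℕ.* n₁ ℕ.+ X i))
    CN-∉S d₁ d₂ (yes d₁≡0) (yes d₂≡0) d≢0 _   = ⊥-elim (d≢0 (cong₂ _,_ d₁≡0 d₂≡0))
    CN-∉S d₁ d₂ (yes refl) (no d₂≢0)  _   _   = inj₁ (CN[0,d₂] d₂≢0)
    CN-∉S d₁ d₂ (no d₁≢0)  (yes d₂≡0) _   d∉S = ⊥-elim (d∉S (inj₁ (d₁≢0 , d₂≡0)))
    CN-∉S d₁ d₂ (no d₁≢0)  (no d₂≢0)  _   d∉S = inj₂ (CN-∉S-≢0 d₁≢0 d₂≢0 (+ C₁.ind d₁ ≋? + C₂.ind d₂) d∉S)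

    nonadjacent-common-neighbours : ∀ x y → x ≢ y → ¬ Adj x y →
      (commonNeighbours Γ′ x y ≡ n₁ ℕ.* (n₂ ℕ.+ 1)) ⊎
      (∃[ i ] ((1 ≤ i × i < m) × commonNeighbours Γ′ x y ≡ 2 ℕ.* n₁ ℕ.+ X i))
    nonadjacent-common-neighbours x@(x₁ , x₂) y@(y₁ , y₂) x≢y ¬x→y =
      Sum.map (trans (commonNeighbours≡CN x y)) (λ (i , 1≤i<m , CN≡) → i , 1≤i<m , trans (commonNeighbours≡CN x y) CN≡)
        (CN-∉S _ _ ((y₁ C₁.- x₁) C₁.≟ C₁.0#) ((y₂ C₂.- x₂) C₂.≟ C₂.0#)
                   y-x≢0 (¬x→y ∘ Equivalence.from Adj⇔InS[y-x]))
      where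
      y-x≢0 : y -G x ≢ 0G
      y-x≢0 y-x≡0 = x≢y (sym (cong₂ _,_ (C₁.x-y≡0⇒x≡y (cong proj₁ y-x≡0)) (C₂.x-y≡0⇒x≡y (cong proj₂ y-x≡0))))

IsNeumaierWithParams⇒IsNeumaier : ∀ {Γ v k λ′ e s} → IsNeumaierWithParams Γ v k λ′ e s → IsNeumaier Γ
IsNeumaierWithParams⇒IsNeumaier (simple , non-complete , edge-regular , (C , regular , _)) =
  simple , non-complete , (_ , _ , _ , edge-regular) , (_ , C , regular)

-- Both sides become the same identity after adding 2 + n₂.
λ-equation⇔ : ∀ N n₁ n₂ x .{{_ : NonZero N}} .{{_ : NonZero n₁}} →
  ((N ∸ 1) ℕ.+ (n₁ ∸ 1) ℕ.* n₂ ≡ (n₁ ∸ 1) ℕ.+ ((n₁ ∸ 1) ℕ.+ x)) ⇔ (x ℕ.+ 2 ℕ.* n₁ ℕ.+ n₂ ≡ suc N ℕ.+ n₁ ℕ.* n₂)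
λ-equation⇔ (suc P) (suc a) n₂ x = mk⇔
  (λ eq → trans x-side (trans (cong (ℕ._+ (2 ℕ.+ n₂)) (sym eq)) N-side))
  (λ eq → ℕ.+-cancelʳ-≡ (2 ℕ.+ n₂) _ _ (trans N-side (trans (sym eq) x-side)))
  where
  open ℕ-Solver.+-*-Solver using (solve; _:=_; _:+_; _:*_; con)
  x-side : x ℕ.+ 2 ℕ.* suc a ℕ.+ n₂ ≡ (a ℕ.+ (a ℕ.+ x)) ℕ.+ (2 ℕ.+ n₂)
  x-side = solve 3 (λ a n x → x :+ con 2 :* (con 1 :+ a) :+ n := (a :+ (a :+ x)) :+ (con 2 :+ n)) refl a n₂ x
  N-side : (P ℕ.+ a ℕ.* n₂) ℕ.+ (2 ℕ.+ n₂) ≡ suc (suc P) ℕ.+ suc a ℕ.* n₂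
  N-side = solve 3 (λ P a n → (P :+ a :* n) :+ (con 2 :+ n) := con 2 :+ P :+ (con 1 :+ a) :* n) refl P a n₂

open import Data.Nat using (_+_; _*_)

theorem3p9 :
    (m n₁ n₂ : ℕ) → 2 ≤ m → 1 ≤ n₁ → 1 ≤ n₂ →
    (F₁ F₂ : FiniteField) →
    FiniteField.order F₁ ≡ 1 + m * n₁ →
    FiniteField.order F₂ ≡ 1 + m * n₂ →
    (α₁ : FiniteField.Carrier F₁) → (α₂ : FiniteField.Carrier F₂) →
    FiniteField.IsPrimitive F₁ α₁ → FiniteField.IsPrimitive F₂ α₂ →
    let q₁ = 1 + m * n₁
        q₂ = 1 + m * n₂
        Γₘ = Γ F₁ F₂ m α₁ α₂
        X : ℕ → ℕ
        X i = 𝒳 m (+ 0) (+ 0) (+ i) F₁ F₂ α₁ α₂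
    in (IsNeumaier Γₘ ⇔
          (((q₁ * n₁) % 2 ≡ (q₂ * n₂) % 2) × (X 0 + 2 * n₁ + n₂ ≡ q₁ + n₁ * n₂)))
       × (IsNeumaier Γₘ →
            IsNeumaierWithParams Γₘ (q₁ * q₂) ((q₁ ∸ 1) * (n₂ + 1))
                                    ((q₁ ∸ 2) + (n₁ ∸ 1) * n₂) n₁ q₁
            × (∀ x y → x ≢ y → ¬ FinDigraph.Adj Γₘ x y →
                 (commonNeighbours Γₘ x y ≡ n₁ * (n₂ + 1))
                 ⊎ (∃[ i ] ((1 ≤ i × i < m) × commonNeighbours Γₘ x y ≡ 2 * n₁ + X i))))
theorem3p9 m n₁ n₂ 2≤m 1≤n₁ 1≤n₂ F₁ F₂ order₁ order₂ α₁ α₂ α₁-primitive α₂-primitive =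
  mk⇔ (Equivalence.to conditions⇔ ∘ Neumaier⇒e₁≋e₂×λ-C≡λ-D)
      (IsNeumaierWithParams⇒IsNeumaier {Γ = Γ′} ∘ uncurry Neumaier-with-parameters ∘ Equivalence.from conditions⇔) ,
  λ Neumaier → let (e₁≋e₂ , λ-C≡λ-D) = Neumaier⇒e₁≋e₂×λ-C≡λ-D Neumaier in
               Neumaier-with-parameters e₁≋e₂ λ-C≡λ-D , nonadjacent-common-neighbours e₁≋e₂
  where
  instance
    m≢0 : NonZero m
    m≢0 = ℕ.>-nonZero (ℕ.<-≤-trans (s≤s z≤n) 2≤m)
    n₁≢0 : NonZero n₁
    n₁≢0 = ℕ.>-nonZero 1≤n₁
    n₂≢0 : NonZero n₂
    n₂≢0 = ℕ.>-nonZero 1≤n₂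
  open Γₘ-Properties m n₁ n₂ F₁ F₂ order₁ order₂ α₁ α₂ α₁-primitive α₂-primitive
  conditions⇔ : (+ C₁.e C₁.≋ + C₂.e × λ-C ≡ λ-D) ⇔
                (((1 + m * n₁) * n₁) % 2 ≡ ((1 + m * n₂) * n₂) % 2 × X 0 + 2 * n₁ + n₂ ≡ (1 + m * n₁) + n₁ * n₂)
  conditions⇔ = e₁≋e₂⇔parity ×-⇔ λ-equation⇔ (m * n₁) n₁ n₂ (X 0) {{C₁.N≢0}}
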